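{- Let $\mathcal B,\mathcal B^*$ be matroids on a finite set $X$ and $B\mapsto B^*$ a linking $\mathcal B\to\mathcal B^*$; let $\omega,\pi,a,z,\varepsilon$ and $\sigma:\mathcal B\to\mathcal B$ be as in the context. Then $\mathfrak W_\omega=\mathfrak W_\pi\circ\sigma$, where for a linear order $\rho$ the map $\mathfrak W_\rho:\mathcal B\to\mathbb N\times\mathbb N$ is $B\mapsto(i_\rho(B),i_\rho(B^*))$.
   Context: A pre-matroid on a finite set $X$ is a non-empty set of subsets of $X$ (bases). For $Y\subseteq X$, $x\notin Y$, $Y+x=Y\cup\{x\}$; for $y\in Y$, $Y-y=Y\setminus\{y\}$. An almost-basis of a pre-matroid $\mathcal C$ is $B-x$ with $B\in\mathcal C$, $x\in B$; $U(D)=\{x\notin D: D+x\in\mathcal C\}$. A matroid is a pre-matroid such that for all bases $B_1,B_2$ and $x\in B_1\setminus B_2$ there is $y\in B_2\setminus B_1$ with $B_1-x+y$ a basis. A transposition exchanges two distinct elements of $X$ and fixes the rest; it acts on subsets elementwise. A bijection $\mathcal B\to\mathcal B^*$, $B\mapsto B^*$, is a linking if for all $B\in\mathcal B$ and transpositions $\tau$: (L1) if $\tau(B)\in\mathcal B$ then $\tau(B^*)\in\mathcal B^*$ and $\tau(B^*)=\tau(B)^*$; (L2) if $\tau(B^*)\in\mathcal B^*$ then $\tau(B)\in\mathcal B$ and $\tau(B^*)=\tau(B)^*$. For a linear order $\rho$ and an almost-basis $D$ of a pre-matroid, $\varphi_\rho(D)=D+\min_\rho U(D)$ (computed in that pre-matroid),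 and for a basis $B$, $i_\rho(B)$ is the number of almost-bases $D$ (of the same pre-matroid) with $\varphi_\rho(D)=B$. Let $\omega$ be a linear order on $X$, $a\ne z$ consecutive for $\omega$ with $a<_\omega z$, $\varepsilon$ the transposition of $a,z$, and $\pi$ the linear order agreeing with $\omega$ except $z<_\pi a$. An almost-basis $D$ is branching if $\varphi_\omega(D)\ne\varphi_\pi(D)$. A basis is a branching image if it equals $\varphi_\omega(A)$ or $\varphi_\pi(A)$ for some branching almost-basis $A$ of the same pre-matroid. For $B\in\mathcal B$ let $\varepsilon_B=\varepsilon$ if $B$ is a branching image in $\mathcal B$ or $B^*$ is a branching image in $\mathcal B^*$, and $\varepsilon_B=\mathrm{id}_X$ otherwise; put $\sigma(B)=\varepsilon_B(B)$ (this lies in $\mathcal B$). -}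

module Defs where

open import Data.Nat using (ℕ; zero; suc; _<_)
open import Data.Bool using (Bool; true; false; _∧_; _∨_; not; if_then_else_)
open import Data.Fin using (Fin; toℕ)
open import Data.Fin.Subset using (Subset; _∈_; _∉_; _∪_; ⁅_⁆; _─_; inside; outside)
open import Data.Fin.Subset.Properties using (_∈?_)
open import Data.Fin.Permutation using (Permutation′; _⟨$⟩ʳ_; _⟨$⟩ˡ_)
import Data.Fin.Permutation.Components as PC
open import Data.Vec using (Vec; []; _∷_; tabulate; lookup)
import Data.Vec.Properties as VecP
open import Data.Fin.Properties using (_≟_)
import Data.Bool.Properties as BoolP
open import Data.List using (List; []; _∷_; map; _++_; filterᵇ; length; allFin)
open import Data.Bool.ListAction using (any)
open import Data.Maybe using (Maybe; just; nothing)
open import Data.Product using (Σ; ∃; _×_; _,_)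
open import Data.Sum using (_⊎_)
open import Relation.Nullary using (¬_; Dec; yes; no; does)
open import Relation.Nullary.Decidable using (⌊_⌋)
open import Relation.Binary.PropositionalEquality using (_≡_; _≢_)
open import Relation.Unary using (Pred)
open import Function.Bundles using (_⇔_)

-- Ground set X = Fin n.  A family of subsets of X (a set of subsets) is given
-- by its (Boolean) membership function.
Family : ℕ → Set
Family n = Subset n → Bool

_∈𝓕_ : ∀ {n} → Subset n → Family n → Set
B ∈𝓕 𝓒 = 𝓒 B ≡ true

_==ˢ_ : ∀ {n} → Subset n → Subset n → Bool
S ==ˢ T = ⌊ VecP.≡-dec BoolP._≟_ S T ⌋

_+ₑ_ : ∀ {n} → Subset n → Fin n → Subset n
Y +ₑ x = Y ∪ ⁅ x ⁆

_-ₑ_ : ∀ {n} → Subset n → Fin n → Subset n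
Y -ₑ y = Y ─ ⁅ y ⁆

IsPreMatroid : ∀ {n} → Family n → Set
IsPreMatroid 𝓒 = ∃ λ B → B ∈𝓕 𝓒

IsMatroid : ∀ {n} → Family n → Set
IsMatroid {n} 𝓒 =
  IsPreMatroid 𝓒 ×
  (∀ B₁ B₂ → B₁ ∈𝓕 𝓒 → B₂ ∈𝓕 𝓒 → (x : Fin n) → x ∈ B₁ → x ∉ B₂ →
     ∃ λ (y : Fin n) → y ∈ B₂ × y ∉ B₁ × ((B₁ -ₑ x) +ₑ y) ∈𝓕 𝓒)

-- the transposition of x and y acting on X, and elementwise on subsets:
-- τ(S) = { τ i | i ∈ S }, i.e. i ∈ τ(S) iff τ i ∈ S (τ is an involution)
transp : ∀ {n} → Fin n → Fin n → Fin n → Fin n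
transp x y = PC.transpose x y

actₛ : ∀ {n} → Fin n → Fin n → Subset n → Subset n
actₛ x y S = tabulate (λ i → lookup S (transp x y i))

record IsLinking {n} (𝓑 𝓑* : Family n) (L : Subset n → Subset n) : Set where
  field
    maps-to   : ∀ B → B ∈𝓕 𝓑 → L B ∈𝓕 𝓑*
    injective : ∀ B C → B ∈𝓕 𝓑 → C ∈𝓕 𝓑 → L B ≡ L C → B ≡ C
    surjective : ∀ C → C ∈𝓕 𝓑* → ∃ λ B → B ∈𝓕 𝓑 × L B ≡ C
    L1 : ∀ B → B ∈𝓕 𝓑 → (x y : Fin n) → x ≢ y →
           actₛ x y B ∈𝓕 𝓑 →
           actₛ x y (L B) ∈𝓕 𝓑* × actₛ x y (L B) ≡ L (actₛ x y B)
    L2 : ∀ B → B ∈𝓕 𝓑 → (x y : Fin n) → x ≢ y →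
           actₛ x y (L B) ∈𝓕 𝓑* →
           actₛ x y B ∈𝓕 𝓑 × actₛ x y (L B) ≡ L (actₛ x y B)

-- A linear order on X is given by a rank permutation ρ : element ↦ position;
-- x <ρ y iff x has smaller position.
LinOrder : ℕ → Set
LinOrder n = Permutation′ n

_<[_]_ : ∀ {n} → Fin n → LinOrder n → Fin n → Set
x <[ ρ ] y = toℕ (ρ ⟨$⟩ʳ x) < toℕ (ρ ⟨$⟩ʳ y)

listOrder : ∀ {n} → LinOrder n → List (Fin n)
listOrder {n} ρ = map (ρ ⟨$⟩ˡ_) (allFin n)

firstSat : ∀ {n} → (Fin n → Bool) → List (Fin n) → Maybe (Fin n)
firstSat p [] = nothing
firstSat p (x ∷ xs) = if p x then just x else firstSat p xs

inU : ∀ {n} → Family n → Subset n → Fin n → Bool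
inU 𝓒 D x = not (does (x ∈? D)) ∧ 𝓒 (D +ₑ x)

allSubsets : ∀ n → List (Subset n)
allSubsets zero = [] ∷ []
allSubsets (suc n) = map (outside ∷_) (allSubsets n) ++ map (inside ∷_) (allSubsets n)

-- D is an almost-basis: D = B - x for some B ∈ 𝓒, x ∈ B.
-- (Equivalently B = D + x with x ∉ D; we search over x.)
isAlmostBasis : ∀ {n} → Family n → Subset n → Bool
isAlmostBasis {n} 𝓒 D = any (λ x → not (does (x ∈? D)) ∧ 𝓒 (D +ₑ x)) (allFin n)

φ : ∀ {n} → LinOrder n → Family n → Subset n → Maybe (Subset n)
φ ρ 𝓒 D with firstSat (inU 𝓒 D) (listOrder ρ)
... | just x  = just (D +ₑ x)
... | nothing = nothing

_==ᵐ_ : ∀ {n} → Maybe (Subset n) → Maybe (Subset n) → Bool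
just S ==ᵐ just T = S ==ˢ T
nothing ==ᵐ nothing = true
_ ==ᵐ _ = false

iρ : ∀ {n} → LinOrder n → Family n → Subset n → ℕ
iρ {n} ρ 𝓒 B =
  length (filterᵇ (λ D → isAlmostBasis 𝓒 D ∧ (φ ρ 𝓒 D ==ᵐ just B)) (allSubsets n))

isBranching : ∀ {n} → LinOrder n → LinOrder n → Family n → Subset n → Bool
isBranching ω π 𝓒 D = isAlmostBasis 𝓒 D ∧ not (φ ω 𝓒 D ==ᵐ φ π 𝓒 D)

isBranchingImage : ∀ {n} → LinOrder n → LinOrder n → Family n → Subset n → Bool
isBranchingImage {n} ω π 𝓒 B =
  any (λ A → isBranching ω π 𝓒 A ∧ ((φ ω 𝓒 A ==ᵐ just B) ∨ (φ π 𝓒 A ==ᵐ just B)))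
      (allSubsets n)

σ : ∀ {n} → LinOrder n → LinOrder n → Fin n → Fin n →
    Family n → Family n → (Subset n → Subset n) → Subset n → Subset n
σ ω π a z 𝓑 𝓑* L B =
  if isBranchingImage ω π 𝓑 B ∨ isBranchingImage ω π 𝓑* (L B)
  then actₛ a z B else B

𝔚 : ∀ {n} → LinOrder n → Family n → Family n → (Subset n → Subset n) →
    Subset n → ℕ × ℕ
𝔚 ρ 𝓑 𝓑* L B = iρ ρ 𝓑 B , iρ ρ 𝓑* (L B)

module Submission where

-- For an almost-basis D, φ_ω(D) and φ_π(D) differ only when a and z are the ω- and π-least
-- elements of U(D), and then they are D + a and D + z; so i_ω and i_π agree on every basis that
-- is not a branching image.  For a branching image B = D₀ + p, with {p, q} = {a, z}, the
-- transposition ε maps the almost-bases sent to D₀ + p by φ_ω bijectively onto those sent to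
-- D₀ + q = ε(B) by φ_π: for D₀ itself this is the interchange of a and z, and for D₀ + p - x the
-- basis exchange axiom shows that x remains the least element of U after replacing p by q.  The
-- hypothesis this needs (a lies below every other element exchangeable with p, or with q) holds
-- at branching images and is carried across the linking by (L1) and (L2), so both coordinates
-- of 𝔚 switch at once.

open import Defs
open import Data.Nat using (ℕ; zero; suc; _<_; _≤_; s≤s)
import Data.Nat.Properties as ℕP
open import Data.Bool using (Bool; true; false; _∧_; _∨_; not; if_then_else_; T; T?)
import Data.Bool.Properties as BoolP
open import Data.Bool.Properties using (T-≡)
open import Data.Bool.ListAction using (any)
open import Data.Fin using (Fin; toℕ)
import Data.Fin as Fin
open import Data.Fin.Properties using (_≟_; toℕ-injective)
open import Data.Fin.Subset using (Subset; inside; outside; ⁅_⁆; _─_) renaming (_∈_ to _∈ˢ_; _∉_ to _∉ˢ_)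
open import Data.Fin.Subset.Properties using (_∈?_; x∈⁅x⁆; x∈⁅y⁆⇒x≡y)
open import Data.Fin.Permutation using (_⟨$⟩ʳ_; _⟨$⟩ˡ_; inverseˡ; inverseʳ)
import Data.Fin.Permutation.Components as PC
open import Data.Vec using ([]; _∷_; lookup)
import Data.Vec.Properties as VecP
import Data.List as List
open import Data.List using (filterᵇ; length)
import Data.List.Properties as ListP
open import Data.List.Membership.Propositional using () renaming (_∈_ to _∈ˡ_)
open import Data.List.Membership.Propositional.Properties using (∈-allFin; ∈-map⁺; ∈-map⁻; ∈-++⁺ˡ; ∈-++⁺ʳ)
open import Data.List.Membership.Propositional.Properties.WithK using (unique∧set⇒bag)
import Data.List.Relation.Unary.All as All
import Data.List.Relation.Unary.AllPairs as AllPairs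
import Data.List.Relation.Unary.Any as Any
open import Data.List.Relation.Unary.Any using (here)
open import Data.List.Relation.Unary.Any.Properties using (any⁺; any⁻)
open import Data.List.Relation.Unary.Unique.Propositional using (Unique)
import Data.List.Relation.Unary.Unique.Propositional.Properties as UniqueP
open import Data.List.Relation.Binary.BagAndSetEquality using (∼bag⇒↭)
open import Data.List.Relation.Binary.Permutation.Propositional using (_↭_)
open import Data.List.Relation.Binary.Permutation.Propositional.Properties using (filter-↭; ↭-length)
open import Data.Maybe using (Maybe; just; nothing)
open import Data.Product using (∃; _×_; _,_; proj₁; proj₂)
open import Data.Sum using (_⊎_; inj₁; inj₂; [_,_]′)
import Data.Sum as Sum
open import Data.Empty using (⊥-elim)
open import Function.Base using (_∘_)
open import Function.Bundles using (_⇔_; mk⇔; Equivalence)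
open import Relation.Nullary using (¬_; yes; no; does)
open import Relation.Nullary.Decidable using (toSum; _×-dec_; _⊎-dec_)
open import Relation.Binary.PropositionalEquality
open import Relation.Binary.Definitions using (tri<; tri≈; tri>)

private
  variable
    n : ℕ

∧-≡true⁻ : {b c : Bool} → b ∧ c ≡ true → b ≡ true × c ≡ true
∧-≡true⁻ {true} {true} _ = refl , refl

∨-≡true⁻ : {b c : Bool} → b ∨ c ≡ true → b ≡ true ⊎ c ≡ true
∨-≡true⁻ {true}  _   = inj₁ refl
∨-≡true⁻ {false} c≡t = inj₂ c≡t

≡true-⇔⇒≡ : {b c : Bool} → b ≡ true ⇔ c ≡ true → b ≡ c
≡true-⇔⇒≡ {false} {false} _   = refl
≡true-⇔⇒≡ {false} {true}  b⇔c = Equivalence.from b⇔c refl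
≡true-⇔⇒≡ {true}  {false} b⇔c = sym (Equivalence.to b⇔c refl)
≡true-⇔⇒≡ {true}  {true}  _   = refl

-- Subsets as Boolean vectors

_∈ᵇ_ : Fin n → Subset n → Set
x ∈ᵇ S = lookup S x ≡ true

_∉ᵇ_ : Fin n → Subset n → Set
x ∉ᵇ S = lookup S x ≡ false

subset-ext : {S T : Subset n} → (∀ i → lookup S i ≡ lookup T i) → S ≡ T
subset-ext {S = S} {T} eq =
  trans (sym (VecP.tabulate∘lookup S)) (trans (VecP.tabulate-cong eq) (VecP.tabulate∘lookup T))

∈ᵇ⇒∈ : {x : Fin n} {S : Subset n} → x ∈ᵇ S → x ∈ˢ S
∈ᵇ⇒∈ {x = x} {S} = VecP.lookup⇒[]= x S

∈⇒∈ᵇ : {x : Fin n} {S : Subset n} → x ∈ˢ S → x ∈ᵇ S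
∈⇒∈ᵇ = VecP.[]=⇒lookup

∉⇒∉ᵇ : {x : Fin n} {S : Subset n} → x ∉ˢ S → x ∉ᵇ S
∉⇒∉ᵇ {x = x} {S} x∉S with lookup S x in eq
... | true  = ⊥-elim (x∉S (∈ᵇ⇒∈ eq))
... | false = refl

∉ᵇ⇒∉ : {x : Fin n} {S : Subset n} → x ∉ᵇ S → x ∉ˢ S
∉ᵇ⇒∉ x∉S x∈S with () ← trans (sym (∈⇒∈ᵇ x∈S)) x∉S

∈ᵇ-∉ᵇ-≢ : (S : Subset n) {x y : Fin n} → x ∈ᵇ S → y ∉ᵇ S → x ≢ y
∈ᵇ-∉ᵇ-≢ S x∈S y∉S refl with () ← trans (sym x∈S) y∉S

x∈ᵇ⁅x⁆ : (x : Fin n) → x ∈ᵇ ⁅ x ⁆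
x∈ᵇ⁅x⁆ x = ∈⇒∈ᵇ (x∈⁅x⁆ x)

lookup-⁅⁆-≢ : {x i : Fin n} → x ≢ i → i ∉ᵇ ⁅ x ⁆
lookup-⁅⁆-≢ {x = x} {i} x≢i = ∉⇒∉ᵇ (λ i∈ → x≢i (sym (x∈⁅y⁆⇒x≡y x i∈)))

lookup-─ : (S T : Subset n) (i : Fin n) → lookup (S ─ T) i ≡ lookup S i ∧ not (lookup T i)
lookup-─ (s ∷ S) (true  ∷ T) Fin.zero = sym (BoolP.∧-zeroʳ s)
lookup-─ (s ∷ S) (false ∷ T) Fin.zero = sym (BoolP.∧-identityʳ s)
lookup-─ (s ∷ S) (t ∷ T) (Fin.suc i) = lookup-─ S T i

∈-+ₑ-self : (S : Subset n) (x : Fin n) → x ∈ᵇ (S +ₑ x)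
∈-+ₑ-self S x = trans (VecP.lookup-zipWith _∨_ x S ⁅ x ⁆) (trans (cong (lookup S x ∨_) (x∈ᵇ⁅x⁆ x)) (BoolP.∨-zeroʳ _))

lookup-+ₑ-≢ : (S : Subset n) {x i : Fin n} → x ≢ i → lookup (S +ₑ x) i ≡ lookup S i
lookup-+ₑ-≢ S {x} {i} x≢i =
  trans (VecP.lookup-zipWith _∨_ i S ⁅ x ⁆) (trans (cong (lookup S i ∨_) (lookup-⁅⁆-≢ x≢i)) (BoolP.∨-identityʳ _))

∉--ₑ-self : (S : Subset n) (x : Fin n) → x ∉ᵇ (S -ₑ x)
∉--ₑ-self S x = trans (lookup-─ S ⁅ x ⁆ x) (trans (cong (λ b → lookup S x ∧ not b) (x∈ᵇ⁅x⁆ x)) (BoolP.∧-zeroʳ _))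

lookup--ₑ-≢ : (S : Subset n) {x i : Fin n} → x ≢ i → lookup (S -ₑ x) i ≡ lookup S i
lookup--ₑ-≢ S {x} {i} x≢i =
  trans (lookup-─ S ⁅ x ⁆ i) (trans (cong (λ b → lookup S i ∧ not b) (lookup-⁅⁆-≢ x≢i)) (BoolP.∧-identityʳ _))

∈-+ₑ⁺ : (S : Subset n) (u : Fin n) {w : Fin n} → w ∈ᵇ S → w ∈ᵇ (S +ₑ u)
∈-+ₑ⁺ S u {w} w∈S with u ≟ w
... | yes refl = ∈-+ₑ-self S u
... | no u≢w   = trans (lookup-+ₑ-≢ S u≢w) w∈S

∉-+ₑ⁺ : (S : Subset n) {u w : Fin n} → u ≢ w → w ∉ᵇ S → w ∉ᵇ (S +ₑ u)
∉-+ₑ⁺ S u≢w w∉S = trans (lookup-+ₑ-≢ S u≢w) w∉S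

∈--ₑ⁺ : (S : Subset n) {u w : Fin n} → u ≢ w → w ∈ᵇ S → w ∈ᵇ (S -ₑ u)
∈--ₑ⁺ S u≢w w∈S = trans (lookup--ₑ-≢ S u≢w) w∈S

∉--ₑ⁺ : (S : Subset n) (u : Fin n) {w : Fin n} → w ∉ᵇ S → w ∉ᵇ (S -ₑ u)
∉--ₑ⁺ S u {w} w∉S with u ≟ w
... | yes refl = ∉--ₑ-self S u
... | no u≢w   = trans (lookup--ₑ-≢ S u≢w) w∉S

∈-+ₑ⁻ : (S : Subset n) {u w : Fin n} → w ∈ᵇ (S +ₑ u) → u ≡ w ⊎ w ∈ᵇ S
∈-+ₑ⁻ S {u} {w} w∈ with u ≟ w
... | yes u≡w = inj₁ u≡w
... | no u≢w  = inj₂ (trans (sym (lookup-+ₑ-≢ S u≢w)) w∈)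

∉-+ₑ⁻ : (S : Subset n) {u w : Fin n} → w ∉ᵇ (S +ₑ u) → u ≢ w × w ∉ᵇ S
∉-+ₑ⁻ S {u} {w} w∉ = u≢w , trans (sym (lookup-+ₑ-≢ S u≢w)) w∉
  where
  u≢w : u ≢ w
  u≢w refl with () ← trans (sym (∈-+ₑ-self S u)) w∉

∈--ₑ⁻ : (S : Subset n) {u w : Fin n} → w ∈ᵇ (S -ₑ u) → u ≢ w × w ∈ᵇ S
∈--ₑ⁻ S {u} {w} w∈ = u≢w , trans (sym (lookup--ₑ-≢ S u≢w)) w∈
  where
  u≢w : u ≢ w
  u≢w refl with () ← trans (sym w∈) (∉--ₑ-self S u)

∉--ₑ⁻ : (S : Subset n) {u w : Fin n} → w ∉ᵇ (S -ₑ u) → u ≡ w ⊎ w ∉ᵇ S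
∉--ₑ⁻ S {u} {w} w∉ with u ≟ w
... | yes u≡w = inj₁ u≡w
... | no u≢w  = inj₂ (trans (sym (lookup--ₑ-≢ S u≢w)) w∉)

-ₑ-+ₑ-cancel : (S : Subset n) {x : Fin n} → x ∈ᵇ S → (S -ₑ x) +ₑ x ≡ S
-ₑ-+ₑ-cancel S {x} x∈S = subset-ext pointwise
  where
  pointwise : ∀ i → lookup ((S -ₑ x) +ₑ x) i ≡ lookup S i
  pointwise i with x ≟ i
  ... | yes refl = trans (∈-+ₑ-self (S -ₑ x) x) (sym x∈S)
  ... | no x≢i   = trans (lookup-+ₑ-≢ (S -ₑ x) x≢i) (lookup--ₑ-≢ S x≢i)

+ₑ--ₑ-cancel : (S : Subset n) {x : Fin n} → x ∉ᵇ S → (S +ₑ x) -ₑ x ≡ S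
+ₑ--ₑ-cancel S {x} x∉S = subset-ext pointwise
  where
  pointwise : ∀ i → lookup ((S +ₑ x) -ₑ x) i ≡ lookup S i
  pointwise i with x ≟ i
  ... | yes refl = trans (∉--ₑ-self (S +ₑ x) x) (sym x∉S)
  ... | no x≢i   = trans (lookup--ₑ-≢ (S +ₑ x) x≢i) (lookup-+ₑ-≢ S x≢i)

+ₑ-comm : (S : Subset n) (x y : Fin n) → (S +ₑ x) +ₑ y ≡ (S +ₑ y) +ₑ x
+ₑ-comm S x y = subset-ext pointwise
  where
  pointwise : ∀ i → lookup ((S +ₑ x) +ₑ y) i ≡ lookup ((S +ₑ y) +ₑ x) i
  pointwise i with x ≟ i | y ≟ i
  ... | yes refl | yes refl = refl
  ... | yes refl | no y≢i   = trans (lookup-+ₑ-≢ (S +ₑ x) y≢i) (trans (∈-+ₑ-self S x) (sym (∈-+ₑ-self (S +ₑ y) x)))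
  ... | no x≢i   | yes refl = trans (∈-+ₑ-self (S +ₑ x) y) (sym (trans (lookup-+ₑ-≢ (S +ₑ y) x≢i) (∈-+ₑ-self S y)))
  ... | no x≢i   | no y≢i   = trans (lookup-+ₑ-≢ (S +ₑ x) y≢i) (trans (lookup-+ₑ-≢ S x≢i)
                                (sym (trans (lookup-+ₑ-≢ (S +ₑ y) x≢i) (lookup-+ₑ-≢ S y≢i))))

+ₑ--ₑ-comm : (S : Subset n) {x y : Fin n} → x ≢ y → (S +ₑ x) -ₑ y ≡ (S -ₑ y) +ₑ x
+ₑ--ₑ-comm S {x} {y} x≢y = subset-ext pointwise
  where
  pointwise : ∀ i → lookup ((S +ₑ x) -ₑ y) i ≡ lookup ((S -ₑ y) +ₑ x) i
  pointwise i with x ≟ i | y ≟ i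
  ... | yes refl | yes refl = ⊥-elim (x≢y refl)
  ... | yes refl | no y≢i   = trans (lookup--ₑ-≢ (S +ₑ x) y≢i) (trans (∈-+ₑ-self S x) (sym (∈-+ₑ-self (S -ₑ y) x)))
  ... | no x≢i   | yes refl = trans (∉--ₑ-self (S +ₑ x) y) (sym (trans (lookup-+ₑ-≢ (S -ₑ y) x≢i) (∉--ₑ-self S y)))
  ... | no x≢i   | no y≢i   = trans (lookup--ₑ-≢ (S +ₑ x) y≢i) (trans (lookup-+ₑ-≢ S x≢i)
                                (sym (trans (lookup-+ₑ-≢ (S -ₑ y) x≢i) (lookup--ₑ-≢ S y≢i))))

-ₑ-comm : (S : Subset n) (x y : Fin n) → (S -ₑ x) -ₑ y ≡ (S -ₑ y) -ₑ x
-ₑ-comm S x y = subset-ext pointwise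
  where
  pointwise : ∀ i → lookup ((S -ₑ x) -ₑ y) i ≡ lookup ((S -ₑ y) -ₑ x) i
  pointwise i with x ≟ i | y ≟ i
  ... | yes refl | yes refl = refl
  ... | yes refl | no y≢i   = trans (lookup--ₑ-≢ (S -ₑ x) y≢i) (trans (∉--ₑ-self S x) (sym (∉--ₑ-self (S -ₑ y) x)))
  ... | no x≢i   | yes refl = trans (∉--ₑ-self (S -ₑ x) y) (sym (trans (lookup--ₑ-≢ (S -ₑ y) x≢i) (∉--ₑ-self S y)))
  ... | no x≢i   | no y≢i   = trans (lookup--ₑ-≢ (S -ₑ x) y≢i) (trans (lookup--ₑ-≢ S x≢i)
                                (sym (trans (lookup--ₑ-≢ (S -ₑ y) x≢i) (lookup--ₑ-≢ S y≢i))))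

+ₑ-swap-around : (D : Subset n) {x p q : Fin n} → p ≢ x → q ≢ x →
                ((D +ₑ p) -ₑ x) +ₑ q ≡ ((D +ₑ q) -ₑ x) +ₑ p
+ₑ-swap-around D {x} {p} {q} p≢x q≢x = begin
  ((D +ₑ p) -ₑ x) +ₑ q  ≡⟨ cong (_+ₑ q) (+ₑ--ₑ-comm D p≢x) ⟩
  ((D -ₑ x) +ₑ p) +ₑ q  ≡⟨ +ₑ-comm (D -ₑ x) p q ⟩
  ((D -ₑ x) +ₑ q) +ₑ p  ≡⟨ cong (_+ₑ p) (sym (+ₑ--ₑ-comm D q≢x)) ⟩
  ((D +ₑ q) -ₑ x) +ₑ p  ∎
  where open ≡-Reasoning

+ₑ--ₑ-cancel-around : (D : Subset n) {x p y : Fin n} → p ∉ᵇ D → p ≢ x → y ≢ p →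
              (((D +ₑ p) -ₑ x) +ₑ y) -ₑ p ≡ (D -ₑ x) +ₑ y
+ₑ--ₑ-cancel-around D {x} {p} {y} p∉D p≢x y≢p = begin
  (((D +ₑ p) -ₑ x) +ₑ y) -ₑ p  ≡⟨ cong (λ S → (S +ₑ y) -ₑ p) (+ₑ--ₑ-comm D p≢x) ⟩
  (((D -ₑ x) +ₑ p) +ₑ y) -ₑ p  ≡⟨ cong (_-ₑ p) (+ₑ-comm (D -ₑ x) p y) ⟩
  (((D -ₑ x) +ₑ y) +ₑ p) -ₑ p  ≡⟨ +ₑ--ₑ-cancel ((D -ₑ x) +ₑ y) (∉-+ₑ⁺ (D -ₑ x) y≢p (∉--ₑ⁺ D x p∉D)) ⟩
  (D -ₑ x) +ₑ y                ∎
  where open ≡-Reasoning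

transp-left : (x y : Fin n) → transp x y x ≡ y
transp-left x y with x ≟ x
... | yes _   = refl
... | no x≢x = ⊥-elim (x≢x refl)

transp-right : (x y : Fin n) → transp x y y ≡ x
transp-right x y with y ≟ x
... | yes refl = refl
... | no _ with y ≟ y
...   | yes _   = refl
...   | no y≢y = ⊥-elim (y≢y refl)

transp-other : {x y k : Fin n} → k ≢ x → k ≢ y → transp x y k ≡ k
transp-other {x = x} {y} {k} k≢x k≢y with k ≟ x
... | yes k≡x = ⊥-elim (k≢x k≡x)
... | no _ with k ≟ y
...   | yes k≡y = ⊥-elim (k≢y k≡y)
...   | no _    = refl

transp-comm : (x y k : Fin n) → transp x y k ≡ transp y x k
transp-comm x y k with toSum (k ≟ x) | toSum (k ≟ y)
... | inj₁ refl | _         = trans (transp-left k y) (sym (transp-right y k))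
... | inj₂ _    | inj₁ refl = trans (transp-right x k) (sym (transp-left k x))
... | inj₂ k≢x  | inj₂ k≢y  = trans (transp-other k≢x k≢y) (sym (transp-other k≢y k≢x))

transp-involutive : (x y k : Fin n) → transp x y (transp x y k) ≡ k
transp-involutive x y k = trans (cong (transp x y) (transp-comm x y k)) (PC.transpose-inverse x y)

lookup-actₛ : (x y : Fin n) (S : Subset n) (i : Fin n) → lookup (actₛ x y S) i ≡ lookup S (transp x y i)
lookup-actₛ x y S = VecP.lookup∘tabulate _

actₛ-involutive : (x y : Fin n) (S : Subset n) → actₛ x y (actₛ x y S) ≡ S
actₛ-involutive x y S = subset-ext λ i →
  trans (lookup-actₛ x y (actₛ x y S) i) (trans (lookup-actₛ x y S _) (cong (lookup S) (transp-involutive x y i)))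

actₛ-comm : (x y : Fin n) (S : Subset n) → actₛ x y S ≡ actₛ y x S
actₛ-comm x y S = subset-ext λ i →
  trans (lookup-actₛ x y S i) (trans (cong (lookup S) (transp-comm x y i)) (sym (lookup-actₛ y x S i)))

actₛ-fixes : (x y : Fin n) (S : Subset n) → lookup S x ≡ lookup S y → actₛ x y S ≡ S
actₛ-fixes x y S eq = subset-ext pointwise
  where
  pointwise : ∀ i → lookup (actₛ x y S) i ≡ lookup S i
  pointwise i with i ≟ x | i ≟ y
  ... | yes refl | _        = trans (lookup-actₛ i y S i) (trans (cong (lookup S) (transp-left i y)) (sym eq))
  ... | no _     | yes refl = trans (lookup-actₛ x i S i) (trans (cong (lookup S) (transp-right x i)) eq)
  ... | no i≢x   | no i≢y   = trans (lookup-actₛ x y S i) (cong (lookup S) (transp-other i≢x i≢y))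

actₛ-fixed⇒ : (x y : Fin n) (S : Subset n) → actₛ x y S ≡ S → lookup S x ≡ lookup S y
actₛ-fixed⇒ x y S eq =
  trans (cong (λ T → lookup T x) (sym eq)) (trans (lookup-actₛ x y S x) (cong (lookup S) (transp-left x y)))

actₛ-exchange : (S : Subset n) {x y : Fin n} → x ∈ᵇ S → y ∉ᵇ S → actₛ x y S ≡ (S -ₑ x) +ₑ y
actₛ-exchange S {x} {y} x∈S y∉S = subset-ext pointwise
  where
  x≢y : x ≢ y
  x≢y = ∈ᵇ-∉ᵇ-≢ S x∈S y∉S
  pointwise : ∀ i → lookup (actₛ x y S) i ≡ lookup ((S -ₑ x) +ₑ y) i
  pointwise i with i ≟ x | i ≟ y
  ... | yes refl | _ = trans (lookup-actₛ i y S i) (trans (cong (lookup S) (transp-left i y))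
                         (trans y∉S (sym (trans (lookup-+ₑ-≢ (S -ₑ i) (x≢y ∘ sym)) (∉--ₑ-self S i)))))
  ... | no _ | yes refl = trans (lookup-actₛ x i S i) (trans (cong (lookup S) (transp-right x i))
                            (trans x∈S (sym (∈-+ₑ-self (S -ₑ x) i))))
  ... | no i≢x | no i≢y = trans (lookup-actₛ x y S i) (trans (cong (lookup S) (transp-other i≢x i≢y))
                            (sym (trans (lookup-+ₑ-≢ (S -ₑ x) (i≢y ∘ sym)) (lookup--ₑ-≢ S (i≢x ∘ sym)))))

actₛ-+ₑ : (S : Subset n) {x y : Fin n} → x ∉ᵇ S → y ∉ᵇ S → x ≢ y → actₛ x y (S +ₑ x) ≡ S +ₑ y
actₛ-+ₑ S {x} {y} x∉S y∉S x≢y = begin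
  actₛ x y (S +ₑ x)      ≡⟨ actₛ-exchange (S +ₑ x) (∈-+ₑ-self S x) (trans (lookup-+ₑ-≢ S x≢y) y∉S) ⟩
  ((S +ₑ x) -ₑ x) +ₑ y   ≡⟨ cong (_+ₑ y) (+ₑ--ₑ-cancel S x∉S) ⟩
  S +ₑ y                 ∎
  where open ≡-Reasoning

-- Linear orders, least elements and φ

Least : LinOrder n → (Fin n → Bool) → Fin n → Set
Least ρ P x = P x ≡ true × (∀ y → P y ≡ true → x ≢ y → x <[ ρ ] y)

least-mono : {ρ₁ ρ₂ : LinOrder n} {P : Fin n → Bool} {x : Fin n} →
             (∀ y → x <[ ρ₁ ] y → x <[ ρ₂ ] y) → Least ρ₁ P x → Least ρ₂ P x
least-mono x<₁⇒x<₂ (Px , x-least) = Px , λ y Py x≢y → x<₁⇒x<₂ y (x-least y Py x≢y)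

module _ (ρ : LinOrder n) where

  <[]-irrefl : {x : Fin n} → ¬ (x <[ ρ ] x)
  <[]-irrefl = ℕP.<-irrefl refl

  rank-injective : {x y : Fin n} → toℕ (ρ ⟨$⟩ʳ x) ≡ toℕ (ρ ⟨$⟩ʳ y) → x ≡ y
  rank-injective eq =
    trans (sym (inverseˡ ρ)) (trans (cong (ρ ⟨$⟩ˡ_) (toℕ-injective eq)) (inverseˡ ρ))

  <[]-cmp : {x y : Fin n} → x ≢ y → x <[ ρ ] y ⊎ y <[ ρ ] x
  <[]-cmp {x} {y} x≢y with ℕP.<-cmp (toℕ (ρ ⟨$⟩ʳ x)) (toℕ (ρ ⟨$⟩ʳ y))
  ... | tri< x<y _ _ = inj₁ x<y
  ... | tri≈ _ eq _  = ⊥-elim (x≢y (rank-injective eq))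
  ... | tri> _ _ y<x = inj₂ y<x

  least-unique : {P : Fin n → Bool} {x y : Fin n} → Least ρ P x → Least ρ P y → x ≡ y
  least-unique {x = x} {y} (Px , x-least) (Py , y-least) with x ≟ y
  ... | yes x≡y = x≡y
  ... | no x≢y  = ⊥-elim (ℕP.<-asym (x-least y Py x≢y) (y-least x Px (x≢y ∘ sym)))

firstSat-tabulate-just : ∀ {m} (P : Fin n → Bool) (h : Fin m → Fin n) {x} →
  firstSat P (List.tabulate h) ≡ just x →
  ∃ λ i → h i ≡ x × P x ≡ true × (∀ j → toℕ j < toℕ i → P (h j) ≡ false)
firstSat-tabulate-just {m = suc m} P h eq with P (h Fin.zero) in Ph₀
firstSat-tabulate-just {m = suc m} P h refl | true = Fin.zero , refl , Ph₀ , λ _ ()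
... | false with firstSat-tabulate-just P (h ∘ Fin.suc) eq
... | i , hi≡x , Px , earlier = Fin.suc i , hi≡x , Px , earlier′
  where
  earlier′ : ∀ j → toℕ j < toℕ (Fin.suc i) → P (h j) ≡ false
  earlier′ Fin.zero    _         = Ph₀
  earlier′ (Fin.suc j) (s≤s j<i) = earlier j j<i

firstSat-tabulate-nothing : ∀ {m} (P : Fin n → Bool) (h : Fin m → Fin n) →
  firstSat P (List.tabulate h) ≡ nothing → ∀ j → P (h j) ≡ false
firstSat-tabulate-nothing {m = suc m} P h eq j with P (h Fin.zero) in Ph₀
firstSat-tabulate-nothing {m = suc m} P h () j | true
firstSat-tabulate-nothing {m = suc m} P h eq Fin.zero | false = Ph₀
firstSat-tabulate-nothing {m = suc m} P h eq (Fin.suc j) | false = firstSat-tabulate-nothing P (h ∘ Fin.suc) eq j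

module _ (ρ : LinOrder n) (P : Fin n → Bool) where

  private
    listOrder≡tabulate : listOrder ρ ≡ List.tabulate (ρ ⟨$⟩ˡ_)
    listOrder≡tabulate = ListP.map-tabulate (λ i → i) (ρ ⟨$⟩ˡ_)

  firstSat-listOrder-just : {x : Fin n} → firstSat P (listOrder ρ) ≡ just x → Least ρ P x
  firstSat-listOrder-just eq rewrite listOrder≡tabulate with firstSat-tabulate-just P (ρ ⟨$⟩ˡ_) eq
  ... | i , refl , Px , earlier = Px , least
    where
    least : ∀ y → P y ≡ true → (ρ ⟨$⟩ˡ i) ≢ y → (ρ ⟨$⟩ˡ i) <[ ρ ] y
    least y Py x≢y with <[]-cmp ρ x≢y
    ... | inj₁ x<y = x<y
    ... | inj₂ y<x with () ← trans (sym Py) (trans (cong P (sym (inverseˡ ρ)))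
                        (earlier (ρ ⟨$⟩ʳ y) (subst (λ k → toℕ (ρ ⟨$⟩ʳ y) < toℕ k) (inverseʳ ρ) y<x)))

  firstSat-listOrder-nothing : firstSat P (listOrder ρ) ≡ nothing → ∀ y → P y ≡ false
  firstSat-listOrder-nothing eq y rewrite listOrder≡tabulate =
    trans (cong P (sym (inverseˡ ρ))) (firstSat-tabulate-nothing P (ρ ⟨$⟩ˡ_) eq (ρ ⟨$⟩ʳ y))

module _ {ρ : LinOrder n} {𝓒 : Family n} {D : Subset n} where

  least-exists : {y : Fin n} → inU 𝓒 D y ≡ true → ∃ (Least ρ (inU 𝓒 D))
  least-exists {y} Uy with firstSat (inU 𝓒 D) (listOrder ρ) in eq
  ... | just x  = x , firstSat-listOrder-just ρ _ eq
  ... | nothing with () ← trans (sym Uy) (firstSat-listOrder-nothing ρ _ eq y)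

  φ-least : {x : Fin n} → Least ρ (inU 𝓒 D) x → φ ρ 𝓒 D ≡ just (D +ₑ x)
  φ-least {x} x-least with firstSat (inU 𝓒 D) (listOrder ρ) in eq
  ... | just x′ = cong (λ u → just (D +ₑ u)) (least-unique ρ (firstSat-listOrder-just ρ _ eq) x-least)
  ... | nothing with () ← trans (sym (proj₁ x-least)) (firstSat-listOrder-nothing ρ _ eq x)

MapsTo : LinOrder n → Family n → Subset n → Subset n → Set
MapsTo ρ 𝓒 D B = ∃ λ x → Least ρ (inU 𝓒 D) x × D +ₑ x ≡ B

φ-just⇒MapsTo : {ρ : LinOrder n} {𝓒 : Family n} (D : Subset n) {B : Subset n} →
                φ ρ 𝓒 D ≡ just B → MapsTo ρ 𝓒 D B
φ-just⇒MapsTo {ρ = ρ} {𝓒} D eq with firstSat (inU 𝓒 D) (listOrder ρ) in fs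
φ-just⇒MapsTo {ρ = ρ} {𝓒} D refl | just x = x , firstSat-listOrder-just ρ _ fs , refl

==ˢ-sound : {S T : Subset n} → (S ==ˢ T) ≡ true → S ≡ T
==ˢ-sound {S = S} {T} eq with VecP.≡-dec BoolP._≟_ S T
... | yes S≡T = S≡T

==ˢ-refl : (S : Subset n) → (S ==ˢ S) ≡ true
==ˢ-refl S with VecP.≡-dec BoolP._≟_ S S
... | yes _  = refl
... | no S≢S = ⊥-elim (S≢S refl)

==ᵐ-sound : {S T : Maybe (Subset n)} → (S ==ᵐ T) ≡ true → S ≡ T
==ᵐ-sound {S = just S}  {just T}  eq = cong just (==ˢ-sound eq)
==ᵐ-sound {S = nothing} {nothing} eq = refl

module _ (𝓒 : Family n) (D : Subset n) where

  isAlmostBasis-intro : {x : Fin n} → inU 𝓒 D x ≡ true → isAlmostBasis 𝓒 D ≡ true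
  isAlmostBasis-intro {x} Ux =
    Equivalence.to T-≡ (any⁺ (inU 𝓒 D) (Any.map (λ { refl → Equivalence.from T-≡ Ux }) (∈-allFin x)))

  isAlmostBasis-elim : isAlmostBasis 𝓒 D ≡ true → ∃ λ x → inU 𝓒 D x ≡ true
  isAlmostBasis-elim eq with x , Ux ← Any.satisfied (any⁻ (inU 𝓒 D) (List.allFin n) (Equivalence.from T-≡ eq))
    = x , Equivalence.to T-≡ Ux

φ-least-==ᵐ : {ρ : LinOrder n} {𝓒 : Family n} {A B : Subset n} {x : Fin n} →
              Least ρ (inU 𝓒 A) x → (φ ρ 𝓒 A ==ᵐ just B) ≡ true → A +ₑ x ≡ B
φ-least-==ᵐ {ρ = ρ} {𝓒} {A} {B} x-least hit with φ ρ 𝓒 A | φ-least {ρ = ρ} {𝓒} {A} x-least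
... | just _ | refl = ==ˢ-sound hit

φ-differ⇒leasts-differ : {ρ₁ ρ₂ : LinOrder n} {𝓒 : Family n} {A : Subset n} {x₁ x₂ : Fin n} →
  Least ρ₁ (inU 𝓒 A) x₁ → Least ρ₂ (inU 𝓒 A) x₂ → not (φ ρ₁ 𝓒 A ==ᵐ φ ρ₂ 𝓒 A) ≡ true → x₁ ≢ x₂
φ-differ⇒leasts-differ {ρ₁ = ρ₁} {ρ₂} {𝓒} {A} {x₁} x₁-least x₂-least differ refl
  with φ ρ₁ 𝓒 A | φ-least {ρ = ρ₁} {𝓒} {A} x₁-least | φ ρ₂ 𝓒 A | φ-least {ρ = ρ₂} {𝓒} {A} x₂-least
... | just _ | refl | just _ | refl with () ← trans (sym differ) (cong not (==ˢ-refl (A +ₑ x₁)))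

mapsTo? : LinOrder n → Family n → Subset n → Subset n → Bool
mapsTo? ρ 𝓒 B D = isAlmostBasis 𝓒 D ∧ (φ ρ 𝓒 D ==ᵐ just B)

mapsTo?⇔MapsTo : (ρ : LinOrder n) (𝓒 : Family n) (B D : Subset n) → mapsTo? ρ 𝓒 B D ≡ true ⇔ MapsTo ρ 𝓒 D B
mapsTo?⇔MapsTo ρ 𝓒 B D = mk⇔ to from
  where
  to : mapsTo? ρ 𝓒 B D ≡ true → MapsTo ρ 𝓒 D B
  to eq = φ-just⇒MapsTo {ρ = ρ} {𝓒} D (==ᵐ-sound {S = φ ρ 𝓒 D} (proj₂ (∧-≡true⁻ {isAlmostBasis 𝓒 D} eq)))
  from : MapsTo ρ 𝓒 D B → mapsTo? ρ 𝓒 B D ≡ true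
  from (x , x-least , refl) = cong₂ _∧_ (isAlmostBasis-intro 𝓒 D (proj₁ x-least))
    (trans (cong (_==ᵐ just (D +ₑ x)) (φ-least {ρ = ρ} {𝓒} {D} x-least)) (==ˢ-refl (D +ₑ x)))

-- Counting over all subsets

count-cong : {A : Set} {p q : A → Bool} → (∀ x → p x ≡ q x) →
             (xs : List.List A) → length (filterᵇ p xs) ≡ length (filterᵇ q xs)
count-cong p≗q xs = cong length (ListP.filter-≐ _ _ ((λ {x} → subst T (p≗q x)) , (λ {x} → subst T (sym (p≗q x)))) xs)

filterᵇ-map : {A : Set} (p : A → Bool) (g : A → A) (xs : List.List A) →
              filterᵇ p (List.map g xs) ≡ List.map g (filterᵇ (p ∘ g) xs)
filterᵇ-map p g List.[] = refl
filterᵇ-map p g (x List.∷ xs) with p (g x)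
... | true  = cong (g x List.∷_) (filterᵇ-map p g xs)
... | false = filterᵇ-map p g xs

∈-allSubsets : (S : Subset n) → S ∈ˡ allSubsets n
∈-allSubsets [] = here refl
∈-allSubsets {suc n} (inside ∷ S)  = ∈-++⁺ʳ (List.map (outside ∷_) (allSubsets n)) (∈-map⁺ (inside ∷_) (∈-allSubsets S))
∈-allSubsets {suc n} (outside ∷ S) = ∈-++⁺ˡ (∈-map⁺ (outside ∷_) (∈-allSubsets S))

allSubsets-unique : ∀ n → Unique (allSubsets n)
allSubsets-unique zero    = All.[] AllPairs.∷ AllPairs.[]
allSubsets-unique (suc n) = UniqueP.++⁺ (UniqueP.map⁺ ∷-injectiveʳ (allSubsets-unique n))
                                        (UniqueP.map⁺ ∷-injectiveʳ (allSubsets-unique n)) disjoint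
  where
  ∷-injectiveʳ : {b : Bool} {S T : Subset n} → _≡_ {A = Subset (suc n)} (b ∷ S) (b ∷ T) → S ≡ T
  ∷-injectiveʳ refl = refl
  disjoint : ∀ {S} → ¬ (S ∈ˡ List.map (outside ∷_) (allSubsets n) × S ∈ˡ List.map (inside ∷_) (allSubsets n))
  disjoint (S∈out , S∈in) with ∈-map⁻ _ S∈out | ∈-map⁻ _ S∈in
  ... | _ , _ , refl | _ , _ , ()

any-allSubsets-false : (p : Subset n → Bool) → any p (allSubsets n) ≡ false → ∀ S → p S ≡ false
any-allSubsets-false p none S with p S in pS
... | false = refl
... | true with () ← trans (sym (Equivalence.to T-≡ (any⁺ p (Any.map (λ { refl → Equivalence.from T-≡ pS })
                                                                      (∈-allSubsets S))))) none

count-involution : (g : Subset n → Subset n) → (∀ S → g (g S) ≡ S) → (p : Subset n → Bool) →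
                   length (filterᵇ (p ∘ g) (allSubsets n)) ≡ length (filterᵇ p (allSubsets n))
count-involution {n} g g-involutive p = begin
  length (filterᵇ (p ∘ g) (allSubsets n))               ≡⟨ sym (ListP.length-map g (filterᵇ (p ∘ g) (allSubsets n))) ⟩
  length (List.map g (filterᵇ (p ∘ g) (allSubsets n)))  ≡⟨ cong length (sym (filterᵇ-map p g (allSubsets n))) ⟩
  length (filterᵇ p (List.map g (allSubsets n)))        ≡⟨ ↭-length (filter-↭ (T? ∘ p) map-g↭id) ⟩
  length (filterᵇ p (allSubsets n))                     ∎
  where
  open ≡-Reasoning
  g-injective : ∀ {S T} → g S ≡ g T → S ≡ T
  g-injective {S} {T} eq = trans (sym (g-involutive S)) (trans (cong g eq) (g-involutive T))
  map-g↭id : List.map g (allSubsets n) ↭ allSubsets n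
  map-g↭id = ∼bag⇒↭ (unique∧set⇒bag (UniqueP.map⁺ g-injective (allSubsets-unique n)) (allSubsets-unique n)
    λ {S} → mk⇔ (λ _ → ∈-allSubsets S)
                (λ _ → subst (_∈ˡ List.map g (allSubsets n)) (g-involutive S) (∈-map⁺ g (∈-allSubsets (g S)))))

iρ-unchanged-off-branchingImages : (ω π : LinOrder n) (𝓒 : Family n) (B : Subset n) →
  isBranchingImage ω π 𝓒 B ≡ false → iρ ω 𝓒 B ≡ iρ π 𝓒 B
iρ-unchanged-off-branchingImages {n} ω π 𝓒 B notImage = count-cong agree (allSubsets n)
  where
  agree : ∀ D → mapsTo? ω 𝓒 B D ≡ mapsTo? π 𝓒 B D
  agree D with isAlmostBasis 𝓒 D | any-allSubsets-false _ notImage D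
  ... | false | _ = refl
  ... | true | notImageOfD with φ ω 𝓒 D ==ᵐ φ π 𝓒 D in same
  -- a branching D is sent to B by neither order, since B is not a branching image
  ...   | true  = cong (_==ᵐ just B) (==ᵐ-sound {S = φ ω 𝓒 D} same)
  ...   | false = trans (BoolP.∨-conicalˡ _ _ notImageOfD) (sym (BoolP.∨-conicalʳ _ _ notImageOfD))

-- Bases, exchanges and the swapped pair {a, z}

does-∈? : (x : Fin n) (S : Subset n) → does (x ∈? S) ≡ lookup S x
does-∈? Fin.zero    (true  ∷ S) = refl
does-∈? Fin.zero    (false ∷ S) = refl
does-∈? (Fin.suc x) (s ∷ S)     = does-∈? x S

inU⁻ : (𝓒 : Family n) (D : Subset n) {x : Fin n} → inU 𝓒 D x ≡ true → x ∉ᵇ D × (D +ₑ x) ∈𝓕 𝓒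
inU⁻ 𝓒 D {x} Ux with x∉D , D+x∈𝓒 ← ∧-≡true⁻ {not (does (x ∈? D))} Ux =
  trans (sym (does-∈? x D)) (BoolP.not-injective x∉D) , D+x∈𝓒

inU⁺ : (𝓒 : Family n) (D : Subset n) {x : Fin n} → x ∉ᵇ D → (D +ₑ x) ∈𝓕 𝓒 → inU 𝓒 D x ≡ true
inU⁺ 𝓒 D {x} x∉D D+x∈𝓒 = cong₂ (λ b c → not b ∧ c) (trans (does-∈? x D) x∉D) D+x∈𝓒

Exchange : Family n → Set
Exchange {n} 𝓒 = ∀ B₁ B₂ → B₁ ∈𝓕 𝓒 → B₂ ∈𝓕 𝓒 → (x : Fin n) → x ∈ˢ B₁ → x ∉ˢ B₂ →
  ∃ λ (y : Fin n) → y ∈ˢ B₂ × y ∉ˢ B₁ × ((B₁ -ₑ x) +ₑ y) ∈𝓕 𝓒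

PairOf : Fin n → Fin n → Fin n → Fin n → Set
PairOf a z p q = (p ≡ a × q ≡ z) ⊎ (p ≡ z × q ≡ a)

module _ {a z p q : Fin n} where

  pairOf-swap : PairOf a z p q → PairOf a z q p
  pairOf-swap (inj₁ (p≡a , q≡z)) = inj₂ (q≡z , p≡a)
  pairOf-swap (inj₂ (p≡z , q≡a)) = inj₁ (q≡a , p≡z)

  pairOf-≢ : a ≢ z → PairOf a z p q → p ≢ q
  pairOf-≢ a≢z (inj₁ (refl , refl)) = a≢z
  pairOf-≢ a≢z (inj₂ (refl , refl)) = a≢z ∘ sym

  pairOf-fst : PairOf a z p q → p ≡ a ⊎ p ≡ z
  pairOf-fst (inj₁ (p≡a , _)) = inj₁ p≡a
  pairOf-fst (inj₂ (p≡z , _)) = inj₂ p≡z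

  pairOf-avoid⁻ : PairOf a z p q → {y : Fin n} → y ≢ p → y ≢ q → y ≢ a × y ≢ z
  pairOf-avoid⁻ (inj₁ (refl , refl)) y≢p y≢q = y≢p , y≢q
  pairOf-avoid⁻ (inj₂ (refl , refl)) y≢p y≢q = y≢q , y≢p

  pairOf-avoid⁺ : PairOf a z p q → {y : Fin n} → y ≢ a → y ≢ z → y ≢ p × y ≢ q
  pairOf-avoid⁺ (inj₁ (refl , refl)) y≢a y≢z = y≢a , y≢z
  pairOf-avoid⁺ (inj₂ (refl , refl)) y≢a y≢z = y≢z , y≢a

  pairOf-∉ : PairOf a z p q → (S : Subset n) → p ∉ᵇ S → q ∉ᵇ S → a ∉ᵇ S × z ∉ᵇ S
  pairOf-∉ (inj₁ (refl , refl)) S p∉S q∉S = p∉S , q∉S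
  pairOf-∉ (inj₂ (refl , refl)) S p∉S q∉S = q∉S , p∉S

  actₛ-pairOf : PairOf a z p q → (S : Subset n) → actₛ p q S ≡ actₛ a z S
  actₛ-pairOf (inj₁ (refl , refl)) S = refl
  actₛ-pairOf (inj₂ (refl , refl)) S = actₛ-comm z a S

≢-outside : {a z u y : Fin n} → u ≡ a ⊎ u ≡ z → y ≢ a → y ≢ z → u ≢ y
≢-outside (inj₁ refl) y≢a y≢z = y≢a ∘ sym
≢-outside (inj₂ refl) y≢a y≢z = y≢z ∘ sym

Adjacent : Fin n → Fin n → LinOrder n → Set
Adjacent a z ρ = ∀ y → y ≢ a → y ≢ z → a <[ ρ ] y ⇔ z <[ ρ ] y

below-pair : {a z u y : Fin n} {ρ : LinOrder n} → Adjacent a z ρ → y ≢ a → y ≢ z →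
             u ≡ a ⊎ u ≡ z → u <[ ρ ] y ⇔ a <[ ρ ] y
below-pair adjacent y≢a y≢z (inj₁ refl) = mk⇔ (λ a<y → a<y) (λ a<y → a<y)
below-pair {a = a} {z} {y = y} {ρ} adjacent y≢a y≢z (inj₂ refl) =
  mk⇔ (Equivalence.from a<y⇔z<y) (Equivalence.to a<y⇔z<y)
  where
  a<y⇔z<y : a <[ ρ ] y ⇔ z <[ ρ ] y
  a<y⇔z<y = adjacent y y≢a y≢z

+ₑ-pairOf : (S : Subset n) {a z p q : Fin n} → PairOf a z p q → (S +ₑ p) +ₑ q ≡ (S +ₑ a) +ₑ z
+ₑ-pairOf S (inj₁ (refl , refl)) = refl
+ₑ-pairOf S (inj₂ (refl , refl)) = +ₑ-comm S _ _

AddsAbove : Family n → Fin n → Fin n → LinOrder n → Subset n → Set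
AddsAbove 𝓒 a z ρ D₀ = ∀ y → inU 𝓒 D₀ y ≡ true → y ≢ a → y ≢ z → a <[ ρ ] y

RemovesAbove : Family n → Fin n → Fin n → LinOrder n → Subset n → Set
RemovesAbove 𝓒 a z ρ D₀ = ∀ y → y ∈ᵇ D₀ → (((D₀ -ₑ y) +ₑ a) +ₑ z) ∈𝓕 𝓒 → a <[ ρ ] y

least⇒addsAbove : {ρ : LinOrder n} {𝓒 : Family n} {A : Subset n} {a z : Fin n} →
                  Least ρ (inU 𝓒 A) a → AddsAbove 𝓒 a z ρ A
least⇒addsAbove (_ , a-least) y Uy y≢a _ = a-least y Uy (y≢a ∘ sym)

ExchangeBound : Family n → Fin n → Fin n → LinOrder n → Subset n → Set
ExchangeBound 𝓒 a z ρ D₀ = AddsAbove 𝓒 a z ρ D₀ ⊎ RemovesAbove 𝓒 a z ρ D₀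

module LeastTransfer {𝓒 : Family n} (exchange : Exchange 𝓒) {a z : Fin n} (a≢z : a ≢ z)
  {ρ : LinOrder n} (adjacent : Adjacent a z ρ) {p q : Fin n} (pq : PairOf a z p q) {D₀ : Subset n}
  (Up : inU 𝓒 D₀ p ≡ true) (Uq : inU 𝓒 D₀ q ≡ true) (bound : ExchangeBound 𝓒 a z ρ D₀)
  {x : Fin n} (x∈D₀ : x ∈ᵇ D₀) where

  private
    Dp Dq : Subset n
    Dp = (D₀ +ₑ p) -ₑ x
    Dq = (D₀ +ₑ q) -ₑ x

    p∉D₀ : p ∉ᵇ D₀
    p∉D₀ = proj₁ (inU⁻ 𝓒 D₀ Up)
    q∉D₀ : q ∉ᵇ D₀
    q∉D₀ = proj₁ (inU⁻ 𝓒 D₀ Uq)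
    x≢p : x ≢ p
    x≢p = ∈ᵇ-∉ᵇ-≢ D₀ x∈D₀ p∉D₀
    x≢q : x ≢ q
    x≢q = ∈ᵇ-∉ᵇ-≢ D₀ x∈D₀ q∉D₀
    x≢a×x≢z : x ≢ a × x ≢ z
    x≢a×x≢z = pairOf-avoid⁻ pq x≢p x≢q
    p≢q : p ≢ q
    p≢q = pairOf-≢ a≢z pq

    p<x-if-a<x : a <[ ρ ] x → p <[ ρ ] x
    p<x-if-a<x = Equivalence.from (below-pair {ρ = ρ} adjacent (proj₁ x≢a×x≢z) (proj₂ x≢a×x≢z) (pairOf-fst pq))

    p<x-if-q<x : q <[ ρ ] x → p <[ ρ ] x
    p<x-if-q<x = p<x-if-a<x ∘ Equivalence.to
      (below-pair {ρ = ρ} adjacent (proj₁ x≢a×x≢z) (proj₂ x≢a×x≢z) (pairOf-fst (pairOf-swap pq)))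

    Witness : Set
    Witness = ∃ λ y′ → inU 𝓒 Dq y′ ≡ true × y′ <[ ρ ] x

    p-witness : (Dq +ₑ p) ∈𝓕 𝓒 → p <[ ρ ] x → Witness
    p-witness Dq+p∈𝓒 p<x = p , inU⁺ 𝓒 Dq (∉--ₑ⁺ (D₀ +ₑ q) x (∉-+ₑ⁺ D₀ (p≢q ∘ sym) p∉D₀)) Dq+p∈𝓒 , p<x

    Dq+p≡D₀-x+a+z : Dq +ₑ p ≡ ((D₀ -ₑ x) +ₑ a) +ₑ z
    Dq+p≡D₀-x+a+z = trans (cong (_+ₑ p) (+ₑ--ₑ-comm D₀ (x≢q ∘ sym))) (+ₑ-pairOf (D₀ -ₑ x) (pairOf-swap pq))

  module _ {y : Fin n} (Uy : inU 𝓒 Dp y ≡ true) (y<x : y <[ ρ ] x) where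

    private
      B₁ : Subset n
      B₁ = Dp +ₑ y

      B₁∈𝓒 : B₁ ∈𝓕 𝓒
      B₁∈𝓒 = proj₂ (inU⁻ 𝓒 Dp Uy)

      D₀+q∈𝓒 : (D₀ +ₑ q) ∈𝓕 𝓒
      D₀+q∈𝓒 = proj₂ (inU⁻ 𝓒 D₀ Uq)

      y≢x : y ≢ x
      y≢x refl = <[]-irrefl ρ y<x

      y∉D₀×p≢y : y ∉ᵇ D₀ × p ≢ y
      y∉D₀×p≢y with ∉--ₑ⁻ (D₀ +ₑ p) (proj₁ (inU⁻ 𝓒 Dp Uy))
      ... | inj₁ x≡y = ⊥-elim (y≢x (sym x≡y))
      ... | inj₂ y∉D₀+p with p≢y , y∉D₀ ← ∉-+ₑ⁻ D₀ y∉D₀+p = y∉D₀ , p≢y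

      y-witness : q ≢ y → (Dq +ₑ y) ∈𝓕 𝓒 → Witness
      y-witness q≢y Dq+y∈𝓒 =
        y , inU⁺ 𝓒 Dq (∉--ₑ⁺ (D₀ +ₑ q) x (∉-+ₑ⁺ D₀ q≢y (proj₁ y∉D₀×p≢y))) Dq+y∈𝓒 , y<x

      B₁-new : ∀ {w} → w ∈ᵇ B₁ → w ∉ᵇ (D₀ +ₑ q) → y ≡ w ⊎ p ≡ w
      B₁-new w∈B₁ w∉D₀+q with ∈-+ₑ⁻ Dp w∈B₁
      ... | inj₁ y≡w = inj₁ y≡w
      ... | inj₂ w∈Dp with ∈-+ₑ⁻ D₀ (proj₂ (∈--ₑ⁻ (D₀ +ₑ p) w∈Dp))
      ...   | inj₁ p≡w = inj₂ p≡w
      ...   | inj₂ w∈D₀ with () ← trans (sym w∈D₀) (proj₂ (∉-+ₑ⁻ D₀ w∉D₀+q))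

      D₀+q-lost : ∀ {w} → w ∈ᵇ (D₀ +ₑ q) → w ∉ᵇ B₁ → x ≡ w ⊎ q ≡ w
      D₀+q-lost w∈D₀+q w∉B₁ with ∉--ₑ⁻ (D₀ +ₑ p) (proj₂ (∉-+ₑ⁻ Dp w∉B₁))
      ... | inj₁ x≡w = inj₁ x≡w
      ... | inj₂ w∉D₀+p with ∈-+ₑ⁻ D₀ w∈D₀+q
      ...   | inj₁ q≡w = inj₂ q≡w
      ...   | inj₂ w∈D₀ with () ← trans (sym w∈D₀) (proj₂ (∉-+ₑ⁻ D₀ w∉D₀+p))

      B₁-p : B₁ -ₑ p ≡ (D₀ -ₑ x) +ₑ y
      B₁-p = +ₑ--ₑ-cancel-around D₀ p∉D₀ (x≢p ∘ sym) (proj₂ y∉D₀×p≢y ∘ sym)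

      B₁-p+q : (B₁ -ₑ p) +ₑ q ≡ Dq +ₑ y
      B₁-p+q = begin
        (B₁ -ₑ p) +ₑ q          ≡⟨ cong (_+ₑ q) B₁-p ⟩
        ((D₀ -ₑ x) +ₑ y) +ₑ q   ≡⟨ +ₑ-comm (D₀ -ₑ x) y q ⟩
        ((D₀ -ₑ x) +ₑ q) +ₑ y   ≡⟨ cong (_+ₑ y) (sym (+ₑ--ₑ-comm D₀ (x≢q ∘ sym))) ⟩
        Dq +ₑ y                 ∎
        where open ≡-Reasoning

      B₁-p+x : (B₁ -ₑ p) +ₑ x ≡ D₀ +ₑ y
      B₁-p+x = begin
        (B₁ -ₑ p) +ₑ x          ≡⟨ cong (_+ₑ x) B₁-p ⟩
        ((D₀ -ₑ x) +ₑ y) +ₑ x   ≡⟨ +ₑ-comm (D₀ -ₑ x) y x ⟩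
        ((D₀ -ₑ x) +ₑ x) +ₑ y   ≡⟨ cong (_+ₑ y) (-ₑ-+ₑ-cancel D₀ x∈D₀) ⟩
        D₀ +ₑ y                 ∎
        where open ≡-Reasoning

      -- Either the bound on D₀ gives p <ρ x directly, or a second exchange, from B₁ back into
      -- D₀ + q, makes y itself a witness or puts y into U(D₀) and hence above a.
      via-p : ExchangeBound 𝓒 a z ρ D₀ → q ≢ y → (Dq +ₑ p) ∈𝓕 𝓒 → Witness
      via-p (inj₂ removesAbove) q≢y Dq+p∈𝓒 = p-witness Dq+p∈𝓒 (p<x-if-a<x (removesAbove x x∈D₀
                                  (subst (_∈𝓕 𝓒) Dq+p≡D₀-x+a+z Dq+p∈𝓒)))
      via-p (inj₁ addsAbove) q≢y Dq+p∈𝓒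
            with exchange B₁ (D₀ +ₑ q) B₁∈𝓒 D₀+q∈𝓒 p
                   (∈ᵇ⇒∈ (∈-+ₑ⁺ Dp y (∈--ₑ⁺ (D₀ +ₑ p) x≢p (∈-+ₑ-self D₀ p))))
                   (∉ᵇ⇒∉ (∉-+ₑ⁺ D₀ (p≢q ∘ sym) p∉D₀))
      ...   | w , w∈ , w∉ , B₁-p+w∈𝓒 with D₀+q-lost (∈⇒∈ᵇ w∈) (∉⇒∉ᵇ w∉)
      ...     | inj₂ refl = y-witness q≢y (subst (_∈𝓕 𝓒) B₁-p+q B₁-p+w∈𝓒)
      ...     | inj₁ refl with y≢a , y≢z ← pairOf-avoid⁻ pq (proj₂ y∉D₀×p≢y ∘ sym) (q≢y ∘ sym) =
        p-witness Dq+p∈𝓒 (p<x-if-a<x (ℕP.<-trans a<y y<x))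
        where
        a<y : a <[ ρ ] y
        a<y = addsAbove y (inU⁺ 𝓒 D₀ (proj₁ y∉D₀×p≢y) (subst (_∈𝓕 𝓒) B₁-p+x B₁-p+w∈𝓒)) y≢a y≢z

    smaller-witness : Witness
    smaller-witness with toSum (y ≟ q)
    ... | inj₁ refl = p-witness (subst (_∈𝓕 𝓒) (+ₑ-swap-around D₀ (x≢p ∘ sym) (x≢q ∘ sym)) B₁∈𝓒) (p<x-if-q<x y<x)
    ... | inj₂ y≢q with exchange (D₀ +ₑ q) B₁ D₀+q∈𝓒 B₁∈𝓒 x (∈ᵇ⇒∈ (∈-+ₑ⁺ D₀ q x∈D₀))
                          (∉ᵇ⇒∉ (∉-+ₑ⁺ Dp y≢x (∉--ₑ-self (D₀ +ₑ p) x)))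
    ...   | w , w∈ , w∉ , Dq+w∈𝓒 with B₁-new (∈⇒∈ᵇ w∈) (∉⇒∉ᵇ w∉)
    ...     | inj₁ refl = y-witness (y≢q ∘ sym) Dq+w∈𝓒
    ...     | inj₂ refl = via-p bound (y≢q ∘ sym) Dq+w∈𝓒

  least-transfer : Least ρ (inU 𝓒 Dq) x → Least ρ (inU 𝓒 Dp) x
  least-transfer (_ , x-least) = Ux , least
    where
    Ux : inU 𝓒 Dp x ≡ true
    Ux = inU⁺ 𝓒 Dp (∉--ₑ-self (D₀ +ₑ p) x)
           (subst (_∈𝓕 𝓒) (sym (-ₑ-+ₑ-cancel (D₀ +ₑ p) (∈-+ₑ⁺ D₀ p x∈D₀))) (proj₂ (inU⁻ 𝓒 D₀ Up)))
    least : ∀ y → inU 𝓒 Dp y ≡ true → x ≢ y → x <[ ρ ] y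
    least y Uy x≢y with <[]-cmp ρ x≢y
    ... | inj₁ x<y = x<y
    ... | inj₂ y<x with y′ , Uy′ , y′<x ← smaller-witness Uy y<x =
      ⊥-elim (ℕP.<-asym y′<x (x-least y′ Uy′ (λ { refl → <[]-irrefl ρ y′<x })))

record AdjacentSwap (a z : Fin n) (ρ₁ ρ₂ : LinOrder n) : Set where
  field
    adjacent : Adjacent a z ρ₁
    agreeˡ   : ∀ x y → x ≢ a → x ≢ z → x <[ ρ₁ ] y → x <[ ρ₂ ] y
    agreeʳ   : ∀ x y → y ≢ a → y ≢ z → x <[ ρ₁ ] y → x <[ ρ₂ ] y
    swapped  : ∀ {p q} → PairOf a z p q → p <[ ρ₁ ] q → q <[ ρ₂ ] p

module _ {a z : Fin n} (a≢z : a ≢ z) {ρ₁ ρ₂ : LinOrder n} (swap : AdjacentSwap a z ρ₁ ρ₂) where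

  open AdjacentSwap swap

  least-swap : {p q : Fin n} → PairOf a z p q → {P : Fin n → Bool} → P q ≡ true → Least ρ₁ P p → Least ρ₂ P q
  least-swap {p} {q} pq {P} Pq (_ , p-least) = Pq , q-least
    where
    q-least : ∀ y → P y ≡ true → q ≢ y → q <[ ρ₂ ] y
    q-least y Py q≢y with p ≟ y
    ... | yes refl = swapped pq (p-least q Pq (pairOf-≢ a≢z pq))
    ... | no p≢y with y≢a , y≢z ← pairOf-avoid⁻ pq (p≢y ∘ sym) (q≢y ∘ sym) =
      agreeʳ q y y≢a y≢z (Equivalence.from (below-pair {ρ = ρ₁} adjacent y≢a y≢z (pairOf-fst (pairOf-swap pq)))
        (Equivalence.to (below-pair {ρ = ρ₁} adjacent y≢a y≢z (pairOf-fst pq)) (p-least y Py p≢y)))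

  exchangeBound-swap : {𝓒 : Family n} {D₀ : Subset n} → a ∉ᵇ D₀ → z ∉ᵇ D₀ →
                       ExchangeBound 𝓒 a z ρ₁ D₀ → ExchangeBound 𝓒 a z ρ₂ D₀
  exchangeBound-swap a∉D₀ z∉D₀ (inj₁ addsAbove) = inj₁ λ y Uy y≢a y≢z → agreeʳ a y y≢a y≢z (addsAbove y Uy y≢a y≢z)
  exchangeBound-swap {D₀ = D₀} a∉D₀ z∉D₀ (inj₂ removesAbove) = inj₂ λ y y∈D₀ D₀-y+a+z∈𝓒 →
    agreeʳ a y (∈ᵇ-∉ᵇ-≢ D₀ y∈D₀ a∉D₀) (∈ᵇ-∉ᵇ-≢ D₀ y∈D₀ z∉D₀) (removesAbove y y∈D₀ D₀-y+a+z∈𝓒)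

module _ {𝓒 : Family n} (exchange : Exchange 𝓒) {a z : Fin n} (a≢z : a ≢ z) {ρ₁ ρ₂ : LinOrder n}
  (swap : AdjacentSwap a z ρ₁ ρ₂) {p q : Fin n} (pq : PairOf a z p q) {D₀ : Subset n}
  (Up : inU 𝓒 D₀ p ≡ true) (Uq : inU 𝓒 D₀ q ≡ true) (bound : ExchangeBound 𝓒 a z ρ₁ D₀) where

  open AdjacentSwap swap

  private
    p∉D₀ : p ∉ᵇ D₀
    p∉D₀ = proj₁ (inU⁻ 𝓒 D₀ Up)
    q∉D₀ : q ∉ᵇ D₀
    q∉D₀ = proj₁ (inU⁻ 𝓒 D₀ Uq)

    az∉D₀ : a ∉ᵇ D₀ × z ∉ᵇ D₀
    az∉D₀ = pairOf-∉ pq D₀ p∉D₀ q∉D₀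

    actₛ-D₀ : actₛ a z D₀ ≡ D₀
    actₛ-D₀ = actₛ-fixes a z D₀ (trans (proj₁ az∉D₀) (sym (proj₂ az∉D₀)))

    actₛ-D₀+p-x : ∀ {x} → x ≢ p → x ≢ q → actₛ a z ((D₀ +ₑ p) -ₑ x) ≡ (D₀ +ₑ q) -ₑ x
    actₛ-D₀+p-x {x} x≢p x≢q = begin
      actₛ a z ((D₀ +ₑ p) -ₑ x)            ≡⟨ sym (actₛ-pairOf pq ((D₀ +ₑ p) -ₑ x)) ⟩
      actₛ p q ((D₀ +ₑ p) -ₑ x)            ≡⟨ actₛ-exchange ((D₀ +ₑ p) -ₑ x) (∈--ₑ⁺ (D₀ +ₑ p) x≢p (∈-+ₑ-self D₀ p))
                                                (∉--ₑ⁺ (D₀ +ₑ p) x (∉-+ₑ⁺ D₀ (pairOf-≢ a≢z pq) q∉D₀)) ⟩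
      (((D₀ +ₑ p) -ₑ x) -ₑ p) +ₑ q         ≡⟨ cong (_+ₑ q) (-ₑ-comm (D₀ +ₑ p) x p) ⟩
      (((D₀ +ₑ p) -ₑ p) -ₑ x) +ₑ q         ≡⟨ cong (λ S → (S -ₑ x) +ₑ q) (+ₑ--ₑ-cancel D₀ p∉D₀) ⟩
      (D₀ -ₑ x) +ₑ q                       ≡⟨ sym (+ₑ--ₑ-comm D₀ (x≢q ∘ sym)) ⟩
      (D₀ +ₑ q) -ₑ x                       ∎
      where open ≡-Reasoning

  mapsTo-swap : (D : Subset n) → MapsTo ρ₁ 𝓒 D (D₀ +ₑ p) → MapsTo ρ₂ 𝓒 (actₛ a z D) (D₀ +ₑ q)
  mapsTo-swap D (x , x-least , D+x≡D₀+p) with x ≟ p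
  ... | yes refl = q , subst (λ S → Least ρ₂ (inU 𝓒 S) q) (sym actₛD≡D₀) (least-swap a≢z swap pq Uq D₀-least)
                     , cong (_+ₑ q) actₛD≡D₀
    where
    D≡D₀ : D ≡ D₀
    D≡D₀ = trans (sym (+ₑ--ₑ-cancel D (proj₁ (inU⁻ 𝓒 D (proj₁ x-least)))))
                 (trans (cong (_-ₑ x) D+x≡D₀+p) (+ₑ--ₑ-cancel D₀ p∉D₀))
    D₀-least : Least ρ₁ (inU 𝓒 D₀) x
    D₀-least = subst (λ S → Least ρ₁ (inU 𝓒 S) x) D≡D₀ x-least
    actₛD≡D₀ : actₛ a z D ≡ D₀
    actₛD≡D₀ = trans (cong (actₛ a z) D≡D₀) actₛ-D₀
  ... | no x≢p = x , subst (λ S → Least ρ₂ (inU 𝓒 S) x) (sym actₛD)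
                       (least-mono {ρ₁ = ρ₁} {ρ₂} (λ y → agreeˡ x y (proj₁ x≢a×x≢z) (proj₂ x≢a×x≢z)) Dq-least)
                   , trans (cong (_+ₑ x) actₛD) (-ₑ-+ₑ-cancel (D₀ +ₑ q) (∈-+ₑ⁺ D₀ q x∈D₀))
    where
    D≡D₀+p-x : D ≡ (D₀ +ₑ p) -ₑ x
    D≡D₀+p-x = trans (sym (+ₑ--ₑ-cancel D (proj₁ (inU⁻ 𝓒 D (proj₁ x-least))))) (cong (_-ₑ x) D+x≡D₀+p)
    x∈D₀ : x ∈ᵇ D₀
    x∈D₀ with ∈-+ₑ⁻ D₀ (subst (x ∈ᵇ_) D+x≡D₀+p (∈-+ₑ-self D x))
    ... | inj₁ p≡x = ⊥-elim (x≢p (sym p≡x))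
    ... | inj₂ x∈D₀ = x∈D₀
    x≢q : x ≢ q
    x≢q = ∈ᵇ-∉ᵇ-≢ D₀ x∈D₀ q∉D₀
    x≢a×x≢z : x ≢ a × x ≢ z
    x≢a×x≢z = pairOf-avoid⁻ pq x≢p x≢q
    actₛD : actₛ a z D ≡ (D₀ +ₑ q) -ₑ x
    actₛD = trans (cong (actₛ a z) D≡D₀+p-x) (actₛ-D₀+p-x x≢p x≢q)
    Dq-least : Least ρ₁ (inU 𝓒 ((D₀ +ₑ q) -ₑ x)) x
    Dq-least = LeastTransfer.least-transfer exchange a≢z {ρ = ρ₁} adjacent (pairOf-swap pq) Uq Up bound x∈D₀
                 (subst (λ S → Least ρ₁ (inU 𝓒 S) x) D≡D₀+p-x x-least)

iρ-pair-swap : {𝓒 : Family n} → Exchange 𝓒 → {a z : Fin n} → a ≢ z → {ρ₁ ρ₂ : LinOrder n} →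
  AdjacentSwap a z ρ₁ ρ₂ → AdjacentSwap a z ρ₂ ρ₁ → {p q : Fin n} → PairOf a z p q → {D₀ : Subset n} →
  inU 𝓒 D₀ p ≡ true → inU 𝓒 D₀ q ≡ true → ExchangeBound 𝓒 a z ρ₁ D₀ →
  iρ ρ₁ 𝓒 (D₀ +ₑ p) ≡ iρ ρ₂ 𝓒 (D₀ +ₑ q)
iρ-pair-swap {n} {𝓒} exchange {a} {z} a≢z {ρ₁} {ρ₂} swap₁₂ swap₂₁ {p} {q} pq {D₀} Up Uq bound =
  trans (count-cong maps-iff (allSubsets n)) (count-involution (actₛ a z) (actₛ-involutive a z) (mapsTo? ρ₂ 𝓒 (D₀ +ₑ q)))
  where
  a∉D₀×z∉D₀ : a ∉ᵇ D₀ × z ∉ᵇ D₀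
  a∉D₀×z∉D₀ = pairOf-∉ pq D₀ (proj₁ (inU⁻ 𝓒 D₀ Up)) (proj₁ (inU⁻ 𝓒 D₀ Uq))
  bound₂ : ExchangeBound 𝓒 a z ρ₂ D₀
  bound₂ = exchangeBound-swap a≢z swap₁₂ {𝓒} {D₀} (proj₁ a∉D₀×z∉D₀) (proj₂ a∉D₀×z∉D₀) bound
  maps-iff : ∀ D → mapsTo? ρ₁ 𝓒 (D₀ +ₑ p) D ≡ mapsTo? ρ₂ 𝓒 (D₀ +ₑ q) (actₛ a z D)
  maps-iff D = ≡true-⇔⇒≡ (mk⇔
    (Equivalence.from (mapsTo?⇔MapsTo ρ₂ 𝓒 _ _) ∘ mapsTo-swap exchange a≢z swap₁₂ pq Up Uq bound D
      ∘ Equivalence.to (mapsTo?⇔MapsTo ρ₁ 𝓒 _ _))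
    (Equivalence.from (mapsTo?⇔MapsTo ρ₁ 𝓒 _ _) ∘ subst (λ S → MapsTo ρ₁ 𝓒 S (D₀ +ₑ p)) (actₛ-involutive a z D)
      ∘ mapsTo-swap exchange a≢z swap₂₁ (pairOf-swap pq) Uq Up bound₂ (actₛ a z D)
      ∘ Equivalence.to (mapsTo?⇔MapsTo ρ₂ 𝓒 _ _)))

-- Transporting the branching data along a linking

record Linked (𝓒 : Family n) (B : Subset n) (𝓒′ : Family n) (B′ : Subset n) : Set where
  field
    swap-∈    : ∀ {x y} → x ≢ y → actₛ x y B ∈𝓕 𝓒 ⇔ actₛ x y B′ ∈𝓕 𝓒′
    same-side : ∀ {x y} → x ≢ y → lookup B x ≡ lookup B y ⇔ lookup B′ x ≡ lookup B′ y

  opposite-side : ∀ {x y} → x ≢ y → lookup B′ x ≢ lookup B′ y → lookup B x ≢ lookup B y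
  opposite-side x≢y B′x≢B′y = B′x≢B′y ∘ Equivalence.to (same-side x≢y)

Linked-sym : {𝓒 𝓒′ : Family n} {B B′ : Subset n} → Linked 𝓒 B 𝓒′ B′ → Linked 𝓒′ B′ 𝓒 B
Linked-sym linked = record
  { swap-∈    = λ x≢y → mk⇔ (Equivalence.from (swap-∈ x≢y)) (Equivalence.to (swap-∈ x≢y))
  ; same-side = λ x≢y → mk⇔ (Equivalence.from (same-side x≢y)) (Equivalence.to (same-side x≢y))
  }
  where open Linked linked

linking⇒Linked : {𝓑 𝓑* : Family n} {L : Subset n → Subset n} → IsLinking 𝓑 𝓑* L →
                 {B : Subset n} → B ∈𝓕 𝓑 → Linked 𝓑 B 𝓑* (L B)
linking⇒Linked {𝓑 = 𝓑} {𝓑*} {L} linking {B} B∈𝓑 = record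
  { swap-∈    = λ {x} {y} x≢y → mk⇔ (proj₁ ∘ L1 B B∈𝓑 x y x≢y) (proj₁ ∘ L2 B B∈𝓑 x y x≢y)
  ; same-side = λ {x} {y} x≢y → mk⇔ (fixed-to x≢y) (fixed-from x≢y)
  }
  where
  open IsLinking linking
  fixed-to : ∀ {x y} → x ≢ y → lookup B x ≡ lookup B y → lookup (L B) x ≡ lookup (L B) y
  fixed-to {x} {y} x≢y Bx≡By = actₛ-fixed⇒ x y (L B)
    (trans (proj₂ (L1 B B∈𝓑 x y x≢y (subst (_∈𝓕 𝓑) (sym fixed) B∈𝓑))) (cong L fixed))
    where
    fixed : actₛ x y B ≡ B
    fixed = actₛ-fixes x y B Bx≡By
  fixed-from : ∀ {x y} → x ≢ y → lookup (L B) x ≡ lookup (L B) y → lookup B x ≡ lookup B y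
  fixed-from {x} {y} x≢y LBx≡LBy = actₛ-fixed⇒ x y B (sym (injective B (actₛ x y B) B∈𝓑 (proj₁ linked)
    (trans (sym fixed) (proj₂ linked))))
    where
    fixed : actₛ x y (L B) ≡ L B
    fixed = actₛ-fixes x y (L B) LBx≡LBy
    linked : actₛ x y B ∈𝓕 𝓑 × actₛ x y (L B) ≡ L (actₛ x y B)
    linked = L2 B B∈𝓑 x y x≢y (subst (_∈𝓕 𝓑*) (sym fixed) (maps-to B B∈𝓑))

ExchangesAbove : Family n → Fin n → Fin n → LinOrder n → Subset n → Fin n → Set
ExchangesAbove 𝓒 a z ρ B u =
  ∀ y → y ≢ a → y ≢ z → lookup B y ≢ lookup B u → actₛ u y B ∈𝓕 𝓒 → a <[ ρ ] y

exchangesAbove-transfer : {𝓒 𝓒′ : Family n} {B B′ : Subset n} → Linked 𝓒 B 𝓒′ B′ →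
  {a z u : Fin n} {ρ : LinOrder n} → u ≡ a ⊎ u ≡ z → ExchangesAbove 𝓒 a z ρ B u → ExchangesAbove 𝓒′ a z ρ B′ u
exchangesAbove-transfer linked {u = u} u∈az above y y≢a y≢z B′y≢B′u u↔y∈𝓒′ =
  above y y≢a y≢z (opposite-side (u≢y ∘ sym) B′y≢B′u) (Equivalence.from (swap-∈ u≢y) u↔y∈𝓒′)
  where
  open Linked linked
  u≢y : u ≢ y
  u≢y = ≢-outside u∈az y≢a y≢z

-- For a branching image A + p the first alternative of bound holds, since a is the ω-least
-- element of U(A); transport along a linking may interchange p and q, giving the second.
record Switchable (𝓒 : Family n) (a z : Fin n) (ρ : LinOrder n) (B : Subset n) : Set where
  field
    p q      : Fin n
    pair     : PairOf a z p q
    p∈B      : p ∈ᵇ B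
    q∉B      : q ∉ᵇ B
    B∈𝓒      : B ∈𝓕 𝓒
    switched : actₛ p q B ∈𝓕 𝓒
    bound    : ExchangesAbove 𝓒 a z ρ B p ⊎ ExchangesAbove 𝓒 a z ρ B q

lookup-≢⇒ : (S : Subset n) {x y : Fin n} → lookup S x ≢ lookup S y → (x ∈ᵇ S × y ∉ᵇ S) ⊎ (y ∈ᵇ S × x ∉ᵇ S)
lookup-≢⇒ S {x} {y} Sx≢Sy with lookup S x | lookup S y
... | true  | false = inj₁ (refl , refl)
... | false | true  = inj₂ (refl , refl)
... | true  | true  = ⊥-elim (Sx≢Sy refl)
... | false | false = ⊥-elim (Sx≢Sy refl)

lookup-≢-∈ᵇ : (S : Subset n) {x y : Fin n} → lookup S x ≢ lookup S y → x ∈ᵇ S → y ∉ᵇ S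
lookup-≢-∈ᵇ S {x} {y} Sx≢Sy x∈S with lookup S y
... | false = refl
... | true  = ⊥-elim (Sx≢Sy x∈S)

∈ᵇ-∉ᵇ-lookup-≢ : (S : Subset n) {x y : Fin n} → x ∈ᵇ S → y ∉ᵇ S → lookup S x ≢ lookup S y
∈ᵇ-∉ᵇ-lookup-≢ S x∈S y∉S Sx≡Sy with () ← trans (sym x∈S) (trans Sx≡Sy y∉S)

switchable-transfer : {𝓒 𝓒′ : Family n} {a z : Fin n} {ρ : LinOrder n} {B B′ : Subset n} → a ≢ z →
  Switchable 𝓒 a z ρ B → Linked 𝓒 B 𝓒′ B′ → B′ ∈𝓕 𝓒′ → Switchable 𝓒′ a z ρ B′
switchable-transfer {𝓒 = 𝓒} {𝓒′} {a} {z} {ρ} {B} {B′} a≢z sw linked B′∈𝓒′ =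
  [ aligned , flipped ]′ (lookup-≢⇒ B′ (∈ᵇ-∉ᵇ-lookup-≢ B p∈B q∉B ∘ Equivalence.from (same-side p≢q)))
  where
  open Switchable sw
  open Linked linked
  p≢q : p ≢ q
  p≢q = pairOf-≢ a≢z pair
  switched′ : actₛ p q B′ ∈𝓕 𝓒′
  switched′ = Equivalence.to (swap-∈ p≢q) switched
  bound′ : ExchangesAbove 𝓒′ a z ρ B′ p ⊎ ExchangesAbove 𝓒′ a z ρ B′ q
  bound′ = Sum.map (exchangesAbove-transfer linked {ρ = ρ} (pairOf-fst pair))
                   (exchangesAbove-transfer linked {ρ = ρ} (pairOf-fst (pairOf-swap pair))) bound
  aligned : p ∈ᵇ B′ × q ∉ᵇ B′ → Switchable 𝓒′ a z ρ B′
  aligned (p∈B′ , q∉B′) = record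
    { p = p ; q = q ; pair = pair ; p∈B = p∈B′ ; q∉B = q∉B′ ; B∈𝓒 = B′∈𝓒′
    ; switched = switched′ ; bound = bound′ }
  flipped : q ∈ᵇ B′ × p ∉ᵇ B′ → Switchable 𝓒′ a z ρ B′
  flipped (q∈B′ , p∉B′) = record
    { p = q ; q = p ; pair = pairOf-swap pair ; p∈B = q∈B′ ; q∉B = p∉B′ ; B∈𝓒 = B′∈𝓒′
    ; switched = subst (_∈𝓕 𝓒′) (actₛ-comm p q B′) switched′ ; bound = Sum.swap bound′ }

iρ-switchable : {𝓒 : Family n} → Exchange 𝓒 → {a z : Fin n} → a ≢ z → {ρ₁ ρ₂ : LinOrder n} →
  AdjacentSwap a z ρ₁ ρ₂ → AdjacentSwap a z ρ₂ ρ₁ → {B : Subset n} → Switchable 𝓒 a z ρ₁ B →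
  iρ ρ₁ 𝓒 B ≡ iρ ρ₂ 𝓒 (actₛ a z B)
iρ-switchable {n} {𝓒} exchange {a} {z} a≢z {ρ₁} {ρ₂} swap₁₂ swap₂₁ {B} sw = begin
  iρ ρ₁ 𝓒 B             ≡⟨ cong (iρ ρ₁ 𝓒) (sym D₀+p≡B) ⟩
  iρ ρ₁ 𝓒 (D₀ +ₑ p)     ≡⟨ iρ-pair-swap exchange a≢z swap₁₂ swap₂₁ pair Up Uq (Sum.map addsAbove removesAbove bound) ⟩
  iρ ρ₂ 𝓒 (D₀ +ₑ q)     ≡⟨ cong (iρ ρ₂ 𝓒) D₀+q≡actₛB ⟩
  iρ ρ₂ 𝓒 (actₛ a z B)  ∎
  where
  open ≡-Reasoning
  open Switchable sw
  D₀ : Subset n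
  D₀ = B -ₑ p
  D₀+p≡B : D₀ +ₑ p ≡ B
  D₀+p≡B = -ₑ-+ₑ-cancel B p∈B
  D₀+q≡actₛB : D₀ +ₑ q ≡ actₛ a z B
  D₀+q≡actₛB = trans (sym (actₛ-exchange B p∈B q∉B)) (actₛ-pairOf pair B)
  Up : inU 𝓒 D₀ p ≡ true
  Up = inU⁺ 𝓒 D₀ (∉--ₑ-self B p) (subst (_∈𝓕 𝓒) (sym D₀+p≡B) B∈𝓒)
  Uq : inU 𝓒 D₀ q ≡ true
  Uq = inU⁺ 𝓒 D₀ (∉--ₑ⁺ B p q∉B) (subst (_∈𝓕 𝓒) (actₛ-exchange B p∈B q∉B) switched)
  actₛ-q-y : ∀ {y} → y ∈ᵇ B → p ≢ y → actₛ q y B ≡ ((D₀ -ₑ y) +ₑ a) +ₑ z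
  actₛ-q-y {y} y∈B p≢y = begin
    actₛ q y B                  ≡⟨ actₛ-comm q y B ⟩
    actₛ y q B                  ≡⟨ actₛ-exchange B y∈B q∉B ⟩
    (B -ₑ y) +ₑ q               ≡⟨ cong (_+ₑ q) (sym (-ₑ-+ₑ-cancel (B -ₑ y) (∈--ₑ⁺ B (p≢y ∘ sym) p∈B))) ⟩
    (((B -ₑ y) -ₑ p) +ₑ p) +ₑ q ≡⟨ cong (λ S → (S +ₑ p) +ₑ q) (-ₑ-comm B y p) ⟩
    ((D₀ -ₑ y) +ₑ p) +ₑ q       ≡⟨ +ₑ-pairOf (D₀ -ₑ y) pair ⟩
    ((D₀ -ₑ y) +ₑ a) +ₑ z       ∎
  addsAbove : ExchangesAbove 𝓒 a z ρ₁ B p → AddsAbove 𝓒 a z ρ₁ D₀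
  addsAbove above y Uy y≢a y≢z with y∉D₀ , D₀+y∈𝓒 ← inU⁻ 𝓒 D₀ Uy =
    above y y≢a y≢z (∈ᵇ-∉ᵇ-lookup-≢ B p∈B y∉B ∘ sym) (subst (_∈𝓕 𝓒) (sym (actₛ-exchange B p∈B y∉B)) D₀+y∈𝓒)
    where
    y∉B : y ∉ᵇ B
    y∉B = trans (sym (lookup--ₑ-≢ B (proj₁ (pairOf-avoid⁺ pair y≢a y≢z) ∘ sym))) y∉D₀
  removesAbove : ExchangesAbove 𝓒 a z ρ₁ B q → RemovesAbove 𝓒 a z ρ₁ D₀
  removesAbove above y y∈D₀ D₀-y+a+z∈𝓒 with p≢y , y∈B ← ∈--ₑ⁻ B y∈D₀
    with y≢a , y≢z ← pairOf-avoid⁻ pair (p≢y ∘ sym) (∈ᵇ-∉ᵇ-≢ B y∈B q∉B) =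
    above y y≢a y≢z (∈ᵇ-∉ᵇ-lookup-≢ B y∈B q∉B) (subst (_∈𝓕 𝓒) (sym (actₛ-q-y y∈B p≢y)) D₀-y+a+z∈𝓒)

switchable-+ₑ : {𝓒 : Family n} {a z : Fin n} → a ≢ z → {ρ : LinOrder n} {A : Subset n} {p q : Fin n} →
  PairOf a z p q → inU 𝓒 A p ≡ true → inU 𝓒 A q ≡ true → AddsAbove 𝓒 a z ρ A → Switchable 𝓒 a z ρ (A +ₑ p)
switchable-+ₑ {𝓒 = 𝓒} {a} {z} a≢z {ρ} {A} {p} {q} pq Up Uq addsAbove
  with p∉A , _ ← inU⁻ 𝓒 A Up | q∉A , A+q∈𝓒 ← inU⁻ 𝓒 A Uq = record
  { p = p ; q = q ; pair = pq ; p∈B = ∈-+ₑ-self A p ; q∉B = ∉-+ₑ⁺ A p≢q q∉A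
  ; B∈𝓒 = proj₂ (inU⁻ 𝓒 A Up)
  ; switched = subst (_∈𝓕 𝓒) (sym (actₛ-+ₑ A p∉A q∉A p≢q)) A+q∈𝓒
  ; bound = inj₁ exchangesAbove }
  where
  p≢q : p ≢ q
  p≢q = pairOf-≢ a≢z pq
  exchangesAbove : ExchangesAbove 𝓒 a z ρ (A +ₑ p) p
  exchangesAbove y y≢a y≢z A+p[y]≢A+p[p] p↔y∈𝓒
    with p≢y , y∉A ← ∉-+ₑ⁻ A (lookup-≢-∈ᵇ (A +ₑ p) (A+p[y]≢A+p[p] ∘ sym) (∈-+ₑ-self A p)) =
    addsAbove y (inU⁺ 𝓒 A y∉A (subst (_∈𝓕 𝓒) (actₛ-+ₑ A p∉A y∉A p≢y) p↔y∈𝓒)) y≢a y≢z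

module AdjacentTransposition {a z : Fin n} {ω π : LinOrder n}
  (z-after-a : toℕ (ω ⟨$⟩ʳ z) ≡ suc (toℕ (ω ⟨$⟩ʳ a)))
  (z<a : z <[ π ] a)
  (agree : ∀ x y → ¬ PairOf a z x y → x <[ π ] y ⇔ x <[ ω ] y) where

  a<z : a <[ ω ] z
  a<z = subst (toℕ (ω ⟨$⟩ʳ a) <_) (sym z-after-a) ℕP.≤-refl

  a≢z : a ≢ z
  a≢z refl = <[]-irrefl ω a<z

  not-pairˡ : ∀ {x y} → x ≢ a → x ≢ z → ¬ PairOf a z x y
  not-pairˡ x≢a x≢z (inj₁ (x≡a , _)) = x≢a x≡a
  not-pairˡ x≢a x≢z (inj₂ (x≡z , _)) = x≢z x≡z

  not-pairʳ : ∀ {x y} → y ≢ a → y ≢ z → ¬ PairOf a z x y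
  not-pairʳ y≢a y≢z (inj₁ (_ , y≡z)) = y≢z y≡z
  not-pairʳ y≢a y≢z (inj₂ (_ , y≡a)) = y≢a y≡a

  adjacent-ω : Adjacent a z ω
  adjacent-ω y y≢a y≢z = mk⇔
    (λ a<y → ℕP.≤∧≢⇒< (subst (_≤ toℕ (ω ⟨$⟩ʳ y)) (sym z-after-a) a<y) (y≢z ∘ sym ∘ rank-injective ω))
    (ℕP.<-trans a<z)

  adjacent-π : Adjacent a z π
  adjacent-π y y≢a y≢z = mk⇔
    (Equivalence.from (agree z y (not-pairʳ y≢a y≢z)) ∘ Equivalence.to (adjacent-ω y y≢a y≢z)
      ∘ Equivalence.to (agree a y (not-pairʳ y≢a y≢z)))
    (Equivalence.from (agree a y (not-pairʳ y≢a y≢z)) ∘ Equivalence.from (adjacent-ω y y≢a y≢z)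
      ∘ Equivalence.to (agree z y (not-pairʳ y≢a y≢z)))

  ω→π : AdjacentSwap a z ω π
  ω→π = record
    { adjacent = adjacent-ω
    ; agreeˡ   = λ x y x≢a x≢z → Equivalence.from (agree x y (not-pairˡ x≢a x≢z))
    ; agreeʳ   = λ x y y≢a y≢z → Equivalence.from (agree x y (not-pairʳ y≢a y≢z))
    ; swapped  = swapped }
    where
    swapped : ∀ {p q} → PairOf a z p q → p <[ ω ] q → q <[ π ] p
    swapped (inj₁ (refl , refl)) _   = z<a
    swapped (inj₂ (refl , refl)) z<a = ⊥-elim (ℕP.<-asym z<a a<z)

  π→ω : AdjacentSwap a z π ω
  π→ω = record
    { adjacent = adjacent-π
    ; agreeˡ   = λ x y x≢a x≢z → Equivalence.to (agree x y (not-pairˡ x≢a x≢z))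
    ; agreeʳ   = λ x y y≢a y≢z → Equivalence.to (agree x y (not-pairʳ y≢a y≢z))
    ; swapped  = swapped }
    where
    swapped : ∀ {p q} → PairOf a z p q → p <[ π ] q → q <[ ω ] p
    swapped (inj₁ (refl , refl)) a<z = ⊥-elim (ℕP.<-asym a<z z<a)
    swapped (inj₂ (refl , refl)) _   = a<z

  leasts-differ : {P : Fin n → Bool} {x x′ : Fin n} → Least ω P x → Least π P x′ → x ≢ x′ → x ≡ a × x′ ≡ z
  leasts-differ {x = x} {x′} (Px , x-least) (Px′ , x′-least) x≢x′
    with (x′ ≟ a ×-dec x ≟ z) ⊎-dec (x′ ≟ z ×-dec x ≟ a)
  ... | yes (inj₂ (x′≡z , x≡a)) = x≡a , x′≡z
  ... | yes (inj₁ (refl , refl)) = ⊥-elim (ℕP.<-asym (x-least x′ Px′ x≢x′) a<z)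
  ... | no not-pair = ⊥-elim (ℕP.<-asym (x-least x′ Px′ x≢x′)
                        (Equivalence.to (agree x′ x not-pair) (x′-least x Px (x≢x′ ∘ sym))))

  branchingImage-switchable : (𝓒 : Family n) {B : Subset n} → isBranchingImage ω π 𝓒 B ≡ true →
                              Switchable 𝓒 a z ω B
  branchingImage-switchable 𝓒 {B} image
    with A , hit ← Any.satisfied (any⁻ _ (allSubsets n) (Equivalence.from T-≡ image))
    with branching , hits-B ← ∧-≡true⁻ (Equivalence.to T-≡ hit)
    with almostBasis , φs-differ ← ∧-≡true⁻ {isAlmostBasis 𝓒 A} branching
    with y , Uy ← isAlmostBasis-elim 𝓒 A almostBasis
    with a′ , a′-least ← least-exists {ρ = ω} {𝓒} {A} Uy
    with z′ , z′-least ← least-exists {ρ = π} {𝓒} {A} Uy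
    with refl , refl ← leasts-differ {P = inU 𝓒 A} a′-least z′-least
                         (φ-differ⇒leasts-differ {ρ₁ = ω} {π} {𝓒} {A} a′-least z′-least φs-differ)
    with ∨-≡true⁻ {φ ω 𝓒 A ==ᵐ just B} hits-B
  ... | inj₁ hitω = subst (Switchable 𝓒 a z ω) (φ-least-==ᵐ {ρ = ω} {𝓒} a′-least hitω)
                      (switchable-+ₑ {𝓒 = 𝓒} a≢z (inj₁ (refl , refl)) (proj₁ a′-least) (proj₁ z′-least)
                         (least⇒addsAbove {ρ = ω} {𝓒} {z = z} a′-least))
  ... | inj₂ hitπ = subst (Switchable 𝓒 a z ω) (φ-least-==ᵐ {ρ = π} {𝓒} z′-least hitπ)
                      (switchable-+ₑ {𝓒 = 𝓒} a≢z (inj₂ (refl , refl)) (proj₁ z′-least) (proj₁ a′-least)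
                         (least⇒addsAbove {ρ = ω} {𝓒} {z = z} a′-least))

  𝔚-switchable : {𝓑 𝓑* : Family n} → Exchange 𝓑 → Exchange 𝓑* → {L : Subset n → Subset n} → IsLinking 𝓑 𝓑* L →
    {B : Subset n} → B ∈𝓕 𝓑 → Switchable 𝓑 a z ω B → Switchable 𝓑* a z ω (L B) →
    𝔚 ω 𝓑 𝓑* L B ≡ 𝔚 π 𝓑 𝓑* L (actₛ a z B)
  𝔚-switchable {𝓑 = 𝓑} {𝓑*} exchange exchange* {L} linking {B} B∈𝓑 sw sw* = cong₂ _,_
    (iρ-switchable exchange a≢z ω→π π→ω sw)
    (trans (iρ-switchable exchange* a≢z ω→π π→ω sw*)
           (cong (iρ π 𝓑*) (proj₂ (IsLinking.L1 linking B B∈𝓑 a z a≢z switched))))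
    where
    switched : actₛ a z B ∈𝓕 𝓑
    switched = subst (_∈𝓕 𝓑) (actₛ-pairOf (Switchable.pair sw) B) (Switchable.switched sw)

corollary10p7 : ∀ {n} (𝓑 𝓑* : Family n) → IsMatroid 𝓑 → IsMatroid 𝓑* →
    (L : Subset n → Subset n) → IsLinking 𝓑 𝓑* L →
    (ω π : LinOrder n) (a z : Fin n) →
    toℕ (ω ⟨$⟩ʳ z) ≡ suc (toℕ (ω ⟨$⟩ʳ a)) →
    z <[ π ] a →
    (∀ x y → ¬ ((x ≡ a × y ≡ z) ⊎ (x ≡ z × y ≡ a)) → (x <[ π ] y ⇔ x <[ ω ] y)) →
    ∀ B → B ∈𝓕 𝓑 →
    𝔚 ω 𝓑 𝓑* L B ≡ 𝔚 π 𝓑 𝓑* L (σ ω π a z 𝓑 𝓑* L B)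
corollary10p7 𝓑 𝓑* (_ , exchange) (_ , exchange*) L linking ω π a z z-after-a z<a agree B B∈𝓑 =
  by-images (isBranchingImage ω π 𝓑 B) refl (isBranchingImage ω π 𝓑* (L B)) refl
  where
  open AdjacentTransposition {a = a} {z} {ω} {π} z-after-a z<a agree
  linked : Linked 𝓑 B 𝓑* (L B)
  linked = linking⇒Linked linking B∈𝓑
  -- σ ω π a z 𝓑 𝓑* L B is the instance b, b* := the two branching-image tests
  by-images : ∀ b → isBranchingImage ω π 𝓑 B ≡ b → ∀ b* → isBranchingImage ω π 𝓑* (L B) ≡ b* →
              𝔚 ω 𝓑 𝓑* L B ≡ 𝔚 π 𝓑 𝓑* L (if b ∨ b* then actₛ a z B else B)
  by-images false image false image* = cong₂ _,_ (iρ-unchanged-off-branchingImages ω π 𝓑 B image)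
                                                 (iρ-unchanged-off-branchingImages ω π 𝓑* (L B) image*)
  by-images true image _ _ =
    𝔚-switchable exchange exchange* linking B∈𝓑 sw
      (switchable-transfer a≢z sw linked (IsLinking.maps-to linking B B∈𝓑))
    where
    sw : Switchable 𝓑 a z ω B
    sw = branchingImage-switchable 𝓑 image
  by-images false _ true image* =
    𝔚-switchable exchange exchange* linking B∈𝓑 (switchable-transfer a≢z sw* (Linked-sym linked) B∈𝓑) sw*
    where
    sw* : Switchable 𝓑* a z ω (L B)
    sw* = branchingImage-switchable 𝓑* image*
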